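{- Let $F_{\mathcal{UD}}(x,y,z)=\sum_{n\ge0}\sum_{I}x^ny^{|I|}z^{r(I)}$, where $I$ ranges over independent sets of the graph $\mathcal{UD}(B_n)$ and $r(I)$ is the number of rows occupied by $I$. Then \[F_{\mathcal{UD}}(x,y,z)=1+xF_{\mathcal{UD}}(x,y,z)+D(x,y,z)F_{\mathcal{UD}}(x,y,z),\qquad D(x,y,z)=\frac{xyz(xy^2z-x+1)}{(xyz+x-1)(xy+x-1)}.\]
   Context: $B_n=\{(i,j):1\le i\le j\le n\}$ ($B_0=\emptyset$), with $i$ the row and $j$ the column. $\mathcal{UD}(B_n)$ is the graph on vertex set $B_n$ in which distinct $(i,j),(k,\ell)$ are adjacent iff $i>k$ and $j<\ell$ (or the same with the cells swapped), or $i<k$, $j<\ell$ and $\{i,\dots,k\}\times\{j,\dots,\ell\}\subseteq B_n$ (or the same with the cells swapped). The rows occupied by $I$ are $\{i:(i,j)\in I\text{ for some }j\}$. The empty set counts as an independent set. -}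

module Defs where

open import Data.Bool using (Bool; true; false; _∧_; _∨_; not; if_then_else_)
open import Data.Nat using (ℕ; zero; suc; _+_; _∸_; _≡ᵇ_; _<ᵇ_; _≤ᵇ_)
open import Data.Product using (_×_; _,_; proj₁; proj₂)
open import Data.List using (List; []; _∷_; map; _++_; length; upTo; filterᵇ; concatMap)
open import Data.Bool.ListAction using (all; any)
open import Data.Integer as ℤ using (ℤ; +_)
open import Relation.Binary.PropositionalEquality using (_≡_)

Cell : Set
Cell = ℕ × ℕ   -- (row i , column j)

range : ℕ → ℕ → List ℕ
range a b = map (λ t → a + t) (upTo (suc b ∸ a))

B : ℕ → List Cell
B n = concatMap (λ i → map (λ j → (i , j)) (range i n)) (range 1 n)

inB : ℕ → Cell → Bool
inB n (i , j) = (1 ≤ᵇ i) ∧ (i ≤ᵇ j) ∧ (j ≤ᵇ n)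

cellEq : Cell → Cell → Bool
cellEq (i , j) (k , l) = (i ≡ᵇ k) ∧ (j ≡ᵇ l)

rectInB : ℕ → Cell → Cell → Bool
rectInB n (i , j) (k , l) = all (λ r → all (λ c → inB n (r , c)) (range j l)) (range i k)

crossing : Cell → Cell → Bool
crossing (i , j) (k , l) = (k <ᵇ i) ∧ (j <ᵇ l)

nested : ℕ → Cell → Cell → Bool
nested n (i , j) (k , l) = (i <ᵇ k) ∧ (j <ᵇ l) ∧ rectInB n (i , j) (k , l)

adjUD : ℕ → Cell → Cell → Bool
adjUD n p q = not (cellEq p q) ∧
  (crossing p q ∨ crossing q p ∨ nested n p q ∨ nested n q p)

-- all sublists (= subsets of a duplicate-free list)
subsets : {A : Set} → List A → List (List A)
subsets []       = [] ∷ []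
subsets (x ∷ xs) = let s = subsets xs in s ++ map (x ∷_) s

independent : ℕ → List Cell → Bool
independent n I = all (λ p → all (λ q → not (adjUD n p q)) I) I

rowsOcc : ℕ → List Cell → ℕ
rowsOcc n I = length (filterᵇ (λ r → any (λ c → proj₁ c ≡ᵇ r) I) (range 1 n))

countUD : ℕ → ℕ → ℕ → ℕ
countUD n a b = length (filterᵇ
  (λ I → independent n I ∧ (length I ≡ᵇ a) ∧ (rowsOcc n I ≡ᵇ b))
  (subsets (B n)))

-- formal power series in x, y, z over ℤ (coefficient of x^n y^a z^b)

PS : Set
PS = ℕ → ℕ → ℕ → ℤ

Σ≤ : ℕ → (ℕ → ℤ) → ℤ
Σ≤ zero    f = f zero
Σ≤ (suc n) f = Σ≤ n f ℤ.+ f (suc n)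

infixl 6 _⊕_ _⊖_
infixl 7 _⊛_
infix 4 _≈_

_⊕_ : PS → PS → PS
(A ⊕ C) n a b = A n a b ℤ.+ C n a b

_⊖_ : PS → PS → PS
(A ⊖ C) n a b = A n a b ℤ.- C n a b

_⊛_ : PS → PS → PS
(A ⊛ C) n a b = Σ≤ n (λ i → Σ≤ a (λ j → Σ≤ b (λ k →
  A i j k ℤ.* C (n ∸ i) (a ∸ j) (b ∸ k))))

_≈_ : PS → PS → Set
A ≈ C = ∀ n a b → A n a b ≡ C n a b

mono : ℕ → ℕ → ℕ → PS
mono p q r n a b = if (n ≡ᵇ p) ∧ (a ≡ᵇ q) ∧ (b ≡ᵇ r) then + 1 else + 0

𝟙 X : PS
𝟙 = mono 0 0 0
X = mono 1 0 0

F-UD : PS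
F-UD n a b = + countUD n a b

-- numerator and denominator of D:
-- D = x y z (x y^2 z - x + 1) / ((x y z + x - 1)(x y + x - 1))
D-num : PS
D-num = mono 1 1 1 ⊛ (mono 1 2 1 ⊖ X ⊕ 𝟙)

D-den : PS
D-den = (mono 1 1 1 ⊕ X ⊖ 𝟙) ⊛ (mono 1 1 0 ⊕ X ⊖ 𝟙)

-- An independent set of UD(B_{n+1}) either avoids the first row, and is then a translate of one of
-- UD(B_n), or it has a rightmost first-row cell (1 , m).  The cells of rows ≤ m that may accompany
-- (1 , m) lie in row 1 to its left or in column m below it, every cell of rows > m is compatible
-- with all of these, and the cells of rows > m form a translate of B_{n+1-m}.  Hence
-- F = 1 + x F + D F, where the coefficient of x^m in D counts the admissible sets in the hook of
-- (1 , m).  Deciding whether (1 , m - 1) is chosen, with the corner (m , m) free in both cases,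
-- gives D (1 - x - x y z) = K, where K counts sets containing (1 , m) and (1 , m - 1) by a binomial
-- coefficient in row 1; Pascal's rule gives K (1 - x - x y) = x y z (x y² z - x + 1).  The
-- denominator has constant term 1, so this determines D.

module Submission where

open import Defs

open import Data.Bool using (Bool; true; false; _∧_; _∨_; not; if_then_else_; T)
open import Data.Bool.ListAction using (all; any)
open import Data.Bool.Properties using (∧-zeroʳ; ∧-identityʳ; ∨-identityʳ; ∨-idem; ∧-comm; ∧-assoc; ∨-comm; ∨-assoc)
open import Data.Empty using (⊥-elim)
open import Data.Integer as Z using (ℤ; +_)
import Data.Integer.Properties as ZP
open import Data.Integer.Solver using (module +-*-Solver)
open import Data.List using (List; []; _∷_; map; _++_; length; applyUpTo; filterᵇ; concat; [_])
open import Data.List.Membership.Propositional using (_∈_)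
open import Data.List.Membership.Propositional.Properties using (∈-++⁺ˡ; ∈-++⁺ʳ)
open import Data.List.Properties using (++-assoc; map-++; length-map; length-++; ++-identityʳ; map-cong; map-∘; filter-++; map-id-local)
open import Data.List.Relation.Unary.All using (All; []; _∷_)
import Data.List.Relation.Unary.All as All
open import Data.List.Relation.Unary.All.Properties using (++⁺)
open import Data.List.Relation.Unary.Any using (here; there)
open import Data.Nat using (ℕ; zero; suc; _+_; _*_; _∸_; _≡ᵇ_; _<ᵇ_; _≤ᵇ_; _≤_; _<_; z≤n; s≤s)
open import Data.Nat.Combinatorics using (_C_; nCk+nC[k+1]≡[n+1]C[k+1])
open import Data.Nat.Induction using (<-rec)
open import Data.Nat.Properties
open import Algebra.Properties.CommutativeSemigroup +-commutativeSemigroup using () renaming (interchange to +-interchange)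
import Data.Nat.Solver as NS
open import Data.Product using (_×_; _,_; proj₁; proj₂)
open import Data.Sum using (_⊎_; inj₁; inj₂)
open import Data.Unit using (⊤; tt)
open import Function using (_∘_)
open import Level using (0ℓ)
open import Relation.Binary using (tri<; tri≈; tri>; Setoid)
import Relation.Binary.Reasoning.Setoid
open import Relation.Binary.PropositionalEquality hiding ([_])
open import Relation.Nullary using (¬_; yes; no)

open +-*-Solver
open NS.+-*-Solver using () renaming (solve to nsolve; _:+_ to _⊹_; _:*_ to _⊠_; _:=_ to _≐_; con to ncon)

χ : Bool → ℕ
χ true = 1
χ false = 0

T⇒≡true : ∀ {b} → T b → b ≡ true
T⇒≡true {true} _ = refl

¬T⇒≡false : ∀ {b} → ¬ T b → b ≡ false
¬T⇒≡false {true} h = ⊥-elim (h tt)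
¬T⇒≡false {false} _ = refl

≡ᵇ-true : ∀ {m n} → m ≡ n → (m ≡ᵇ n) ≡ true
≡ᵇ-true {m} {n} e = T⇒≡true (≡⇒≡ᵇ m n e)

≡ᵇ-false : ∀ {m n} → m ≢ n → (m ≡ᵇ n) ≡ false
≡ᵇ-false {m} {n} ne = ¬T⇒≡false (λ t → ne (≡ᵇ⇒≡ m n t))

<ᵇ-true : ∀ {m n} → m < n → (m <ᵇ n) ≡ true
<ᵇ-true lt = T⇒≡true (<⇒<ᵇ lt)

<ᵇ-false : ∀ {m n} → ¬ m < n → (m <ᵇ n) ≡ false
<ᵇ-false {m} {n} nl = ¬T⇒≡false (λ t → nl (<ᵇ⇒< m n t))

≤ᵇ-true : ∀ {m n} → m ≤ n → (m ≤ᵇ n) ≡ true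
≤ᵇ-true le = T⇒≡true (≤⇒≤ᵇ le)

≤ᵇ-false : ∀ {m n} → ¬ m ≤ n → (m ≤ᵇ n) ≡ false
≤ᵇ-false {m} {n} nl = ¬T⇒≡false (λ t → nl (≤ᵇ⇒≤ m n t))

<ᵇ-suc : ∀ k j → (k <ᵇ suc j) ≡ (k ≤ᵇ j)
<ᵇ-suc zero j = refl
<ᵇ-suc (suc k) j = refl

n<ᵇn : ∀ n → (n <ᵇ n) ≡ false
n<ᵇn n = <ᵇ-false (n≮n n)

0≡ᵇ∸ : ∀ j j' → j' ≤ j → (0 ≡ᵇ j ∸ j') ≡ (j ≡ᵇ j')
0≡ᵇ∸ j j' le with j ≟ j'
... | yes refl rewrite n∸n≡0 j | ≡ᵇ-true {j} refl = refl
... | no ne rewrite ≡ᵇ-false ne = ≡ᵇ-false (λ e → ne (sym (≤-antisym le (m∸n≡0⇒m≤n (sym e)))))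

1≡ᵇ∸ : ∀ j j' → j' ≤ j → (1 ≡ᵇ j ∸ j') ≡ (1 ≤ᵇ j) ∧ (j ∸ 1 ≡ᵇ j')
1≡ᵇ∸ zero .zero z≤n = refl
1≡ᵇ∸ (suc j) j' le with j ≟ j'
... | yes refl rewrite ≡ᵇ-true {j} refl | +-∸-assoc 1 {j} {j} ≤-refl | n∸n≡0 j = refl
... | no ne rewrite ≡ᵇ-false ne = ≡ᵇ-false (λ e → ne (sym (suc-injective (trans (cong (_+ j') e) (m∸n+n≡m le)))))

χ-∧ : ∀ p q → χ (p ∧ q) ≡ χ p * χ q
χ-∧ true q = sym (+-identityʳ (χ q))
χ-∧ false q = refl

Σℕ : ℕ → (ℕ → ℕ) → ℕ
Σℕ zero f = f zero
Σℕ (suc n) f = Σℕ n f + f (suc n)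

Σℕ-cong : ∀ n {f g : ℕ → ℕ} → (∀ i → f i ≡ g i) → Σℕ n f ≡ Σℕ n g
Σℕ-cong zero e = e zero
Σℕ-cong (suc n) e = cong₂ _+_ (Σℕ-cong n e) (e (suc n))

Σℕ-cong-≤ : ∀ n {f g : ℕ → ℕ} → (∀ i → i ≤ n → f i ≡ g i) → Σℕ n f ≡ Σℕ n g
Σℕ-cong-≤ zero e = e zero z≤n
Σℕ-cong-≤ (suc n) e = cong₂ _+_ (Σℕ-cong-≤ n (λ i le → e i (m≤n⇒m≤1+n le))) (e (suc n) ≤-refl)

Σℕ-+ : ∀ n (f g : ℕ → ℕ) → Σℕ n (λ i → f i + g i) ≡ Σℕ n f + Σℕ n g
Σℕ-+ zero f g = refl
Σℕ-+ (suc n) f g = trans (cong (_+ (f (suc n) + g (suc n))) (Σℕ-+ n f g)) (+-interchange (Σℕ n f) (Σℕ n g) (f (suc n)) (g (suc n)))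

Σℕ-*ˡ : ∀ n c (f : ℕ → ℕ) → Σℕ n (λ i → c * f i) ≡ c * Σℕ n f
Σℕ-*ˡ zero c f = refl
Σℕ-*ˡ (suc n) c f = trans (cong (_+ c * f (suc n)) (Σℕ-*ˡ n c f)) (sym (*-distribˡ-+ c _ _))

Σℕ-*ʳ : ∀ n c (f : ℕ → ℕ) → Σℕ n (λ i → f i * c) ≡ Σℕ n f * c
Σℕ-*ʳ n c f = trans (Σℕ-cong n (λ i → *-comm (f i) c)) (trans (Σℕ-*ˡ n c f) (*-comm c _))

Σℕ-0 : ∀ n → Σℕ n (λ _ → 0) ≡ 0
Σℕ-0 zero = refl
Σℕ-0 (suc n) = cong (_+ 0) (Σℕ-0 n)

Σℕ-*-Σℕ : ∀ a b (f g : ℕ → ℕ) → Σℕ a (λ j → Σℕ b (λ k → f j * g k)) ≡ Σℕ a f * Σℕ b g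
Σℕ-*-Σℕ a b f g = trans (Σℕ-cong a (λ j → Σℕ-*ˡ b (f j) g)) (Σℕ-*ʳ a (Σℕ b g) f)

Σℕ-δ : ∀ n x (g : ℕ → ℕ) → Σℕ n (λ j → χ (x ≡ᵇ j) * g j) ≡ χ (x ≤ᵇ n) * g x
Σℕ-δ zero zero g = refl
Σℕ-δ zero (suc x) g = refl
Σℕ-δ (suc n) x g with <-cmp x (suc n)
... | tri< lt _ _ rewrite Σℕ-δ n x g | ≤ᵇ-true (≤-pred lt) | ≡ᵇ-false {x} {suc n} (<⇒≢ lt) | ≤ᵇ-true (<⇒≤ lt) = +-identityʳ _
... | tri≈ _ refl _ rewrite Σℕ-δ n (suc n) g | ≤ᵇ-false {suc n} {n} (<⇒≱ ≤-refl) | ≡ᵇ-true {suc n} refl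
                          | ≤ᵇ-true {suc n} {suc n} ≤-refl = refl
... | tri> _ _ gt rewrite Σℕ-δ n x g | ≤ᵇ-false {x} {n} (<⇒≱ (<-trans (n<1+n n) gt)) | ≡ᵇ-false {x} {suc n} (>⇒≢ gt)
                        | ≤ᵇ-false {x} {suc n} (<⇒≱ gt) = refl

Σℕ-δ² : ∀ j k x y (A : ℕ → ℕ → ℕ) → x ≤ j → y ≤ k →
  Σℕ j (λ j' → Σℕ k (λ k' → χ (x ≡ᵇ j') * (χ (y ≡ᵇ k') * A j' k'))) ≡ A x y
Σℕ-δ² j k x y A x≤j y≤k = begin
  Σℕ j (λ j' → Σℕ k (λ k' → χ (x ≡ᵇ j') * (χ (y ≡ᵇ k') * A j' k')))
    ≡⟨ Σℕ-cong j (λ j' → trans (Σℕ-*ˡ k (χ (x ≡ᵇ j')) _) (cong (χ (x ≡ᵇ j') *_) (Σℕ-δ k y (A j')))) ⟩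
  Σℕ j (λ j' → χ (x ≡ᵇ j') * (χ (y ≤ᵇ k) * A j' y))     ≡⟨ Σℕ-δ j x (λ j' → χ (y ≤ᵇ k) * A j' y) ⟩
  χ (x ≤ᵇ j) * (χ (y ≤ᵇ k) * A x y)                     ≡⟨ cong₂ (λ p q → χ p * (χ q * A x y)) (≤ᵇ-true x≤j) (≤ᵇ-true y≤k) ⟩
  1 * (1 * A x y)                                      ≡⟨ trans (*-identityˡ _) (*-identityˡ _) ⟩
  A x y                                                ∎
  where open ≡-Reasoning

χ-+≡ᵇ : ∀ x y a → χ (x + y ≡ᵇ a) ≡ Σℕ a (λ j → χ (x ≡ᵇ j) * χ (y ≡ᵇ a ∸ j))
χ-+≡ᵇ x y a rewrite Σℕ-δ a x (λ j → χ (y ≡ᵇ a ∸ j)) with x ≤? a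
... | yes le rewrite ≤ᵇ-true le = trans (cong χ +≡ᵇ⇔≡ᵇ∸) (sym (+-identityʳ _))
  where
  +≡ᵇ⇔≡ᵇ∸ : (x + y ≡ᵇ a) ≡ (y ≡ᵇ a ∸ x)
  +≡ᵇ⇔≡ᵇ∸ with y ≟ a ∸ x
  ... | yes e = trans (≡ᵇ-true (trans (cong (_+_ x) e) (m+[n∸m]≡n le))) (sym (≡ᵇ-true e))
  ... | no ne = trans (≡ᵇ-false (λ e → ne (trans (sym (m+n∸m≡n x y)) (cong (_∸ x) e)))) (sym (≡ᵇ-false ne))
... | no nle rewrite ≤ᵇ-false nle = cong χ (≡ᵇ-false (λ e → nle (subst (x ≤_) e (m≤m+n x y))))

χ-convolution : ∀ β₁ β₂ x₁ x₂ y₁ y₂ a b →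
  χ ((β₁ ∧ β₂) ∧ ((x₁ + x₂ ≡ᵇ a) ∧ (y₁ + y₂ ≡ᵇ b))) ≡
  Σℕ a (λ j → Σℕ b (λ k → χ (β₁ ∧ ((x₁ ≡ᵇ j) ∧ (y₁ ≡ᵇ k))) * χ (β₂ ∧ ((x₂ ≡ᵇ a ∸ j) ∧ (y₂ ≡ᵇ b ∸ k)))))
χ-convolution β₁ β₂ x₁ x₂ y₁ y₂ a b = begin
  χ ((β₁ ∧ β₂) ∧ ((x₁ + x₂ ≡ᵇ a) ∧ (y₁ + y₂ ≡ᵇ b)))
    ≡⟨ trans (χ-∧ (β₁ ∧ β₂) _) (cong₂ _*_ (χ-∧ β₁ β₂) (χ-∧ (x₁ + x₂ ≡ᵇ a) _)) ⟩
  c * (χ (x₁ + x₂ ≡ᵇ a) * χ (y₁ + y₂ ≡ᵇ b))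
    ≡⟨ cong (c *_) (cong₂ _*_ (χ-+≡ᵇ x₁ x₂ a) (χ-+≡ᵇ y₁ y₂ b)) ⟩
  c * (Σℕ a u * Σℕ b v)
    ≡⟨ cong (c *_) (sym (Σℕ-*-Σℕ a b u v)) ⟩
  c * Σℕ a (λ j → Σℕ b (λ k → u j * v k))
    ≡⟨ sym (Σℕ-*ˡ a c _) ⟩
  Σℕ a (λ j → c * Σℕ b (λ k → u j * v k))
    ≡⟨ Σℕ-cong a (λ j → trans (sym (Σℕ-*ˡ b c _)) (Σℕ-cong b (regroup j))) ⟩
  Σℕ a (λ j → Σℕ b (λ k → χ (β₁ ∧ ((x₁ ≡ᵇ j) ∧ (y₁ ≡ᵇ k))) * χ (β₂ ∧ ((x₂ ≡ᵇ a ∸ j) ∧ (y₂ ≡ᵇ b ∸ k))))) ∎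
  where
  open ≡-Reasoning
  c : ℕ
  c = χ β₁ * χ β₂
  u v : ℕ → ℕ
  u = λ j → χ (x₁ ≡ᵇ j) * χ (x₂ ≡ᵇ a ∸ j)
  v = λ k → χ (y₁ ≡ᵇ k) * χ (y₂ ≡ᵇ b ∸ k)
  regroup : ∀ j k → c * (u j * v k) ≡
    χ (β₁ ∧ ((x₁ ≡ᵇ j) ∧ (y₁ ≡ᵇ k))) * χ (β₂ ∧ ((x₂ ≡ᵇ a ∸ j) ∧ (y₂ ≡ᵇ b ∸ k)))
  regroup j k rewrite χ-∧ β₁ ((x₁ ≡ᵇ j) ∧ (y₁ ≡ᵇ k)) | χ-∧ (x₁ ≡ᵇ j) (y₁ ≡ᵇ k)
    | χ-∧ β₂ ((x₂ ≡ᵇ a ∸ j) ∧ (y₂ ≡ᵇ b ∸ k)) | χ-∧ (x₂ ≡ᵇ a ∸ j) (y₂ ≡ᵇ b ∸ k) =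
    nsolve 6 (λ p q r s t u → (p ⊠ q) ⊠ ((r ⊠ s) ⊠ (t ⊠ u)) ≐ (p ⊠ (r ⊠ t)) ⊠ (q ⊠ (s ⊠ u))) refl
      (χ β₁) (χ β₂) (χ (x₁ ≡ᵇ j)) (χ (x₂ ≡ᵇ a ∸ j)) (χ (y₁ ≡ᵇ k)) (χ (y₂ ≡ᵇ b ∸ k))

-- The weight 1 + y z of a single cell that may or may not be chosen.
cellWeight : ℕ → ℕ → ℕ
cellWeight x y = χ ((0 ≡ᵇ x) ∧ (0 ≡ᵇ y)) + χ ((1 ≡ᵇ x) ∧ (1 ≡ᵇ y))

Σℕ-cellWeight : ∀ (A : ℕ → ℕ → ℕ) j k →
  Σℕ j (λ j' → Σℕ k (λ k' → A j' k' * cellWeight (j ∸ j') (k ∸ k'))) ≡ A j k + χ ((1 ≤ᵇ j) ∧ (1 ≤ᵇ k)) * A (j ∸ 1) (k ∸ 1)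
Σℕ-cellWeight A j k = begin
  Σℕ j (λ j' → Σℕ k (λ k' → A j' k' * cellWeight (j ∸ j') (k ∸ k')))
    ≡⟨ Σℕ-cong-≤ j (λ j' lj → Σℕ-cong-≤ k (λ k' lk → split j' k' lj lk)) ⟩
  Σℕ j (λ j' → Σℕ k (λ k' → δ j k j' k' + c * δ (j ∸ 1) (k ∸ 1) j' k'))
    ≡⟨ trans (Σℕ-cong j (λ j' → Σℕ-+ k _ _)) (Σℕ-+ j _ _) ⟩
  Σℕ j (λ j' → Σℕ k (δ j k j')) + Σℕ j (λ j' → Σℕ k (λ k' → c * δ (j ∸ 1) (k ∸ 1) j' k'))
    ≡⟨ cong (_+_ (Σℕ j (λ j' → Σℕ k (δ j k j')))) (trans (Σℕ-cong j (λ j' → Σℕ-*ˡ k c _)) (Σℕ-*ˡ j c _)) ⟩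
  Σℕ j (λ j' → Σℕ k (δ j k j')) + c * Σℕ j (λ j' → Σℕ k (δ (j ∸ 1) (k ∸ 1) j'))
    ≡⟨ cong₂ (λ p q → p + c * q) (Σℕ-δ² j k j k A ≤-refl ≤-refl) (Σℕ-δ² j k (j ∸ 1) (k ∸ 1) A (m∸n≤m j 1) (m∸n≤m k 1)) ⟩
  A j k + c * A (j ∸ 1) (k ∸ 1)
    ≡⟨ cong (λ p → A j k + p * A (j ∸ 1) (k ∸ 1)) (sym (χ-∧ (1 ≤ᵇ j) (1 ≤ᵇ k))) ⟩
  A j k + χ ((1 ≤ᵇ j) ∧ (1 ≤ᵇ k)) * A (j ∸ 1) (k ∸ 1) ∎
  where
  open ≡-Reasoning
  c : ℕ
  c = χ (1 ≤ᵇ j) * χ (1 ≤ᵇ k)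
  δ : ℕ → ℕ → ℕ → ℕ → ℕ
  δ x y j' k' = χ (x ≡ᵇ j') * (χ (y ≡ᵇ k') * A j' k')
  split : ∀ j' k' → j' ≤ j → k' ≤ k → A j' k' * cellWeight (j ∸ j') (k ∸ k') ≡ δ j k j' k' + c * δ (j ∸ 1) (k ∸ 1) j' k'
  split j' k' lj lk rewrite 0≡ᵇ∸ j j' lj | 0≡ᵇ∸ k k' lk | 1≡ᵇ∸ j j' lj | 1≡ᵇ∸ k k' lk
    | χ-∧ (j ≡ᵇ j') (k ≡ᵇ k') | χ-∧ ((1 ≤ᵇ j) ∧ (j ∸ 1 ≡ᵇ j')) ((1 ≤ᵇ k) ∧ (k ∸ 1 ≡ᵇ k'))
    | χ-∧ (1 ≤ᵇ j) (j ∸ 1 ≡ᵇ j') | χ-∧ (1 ≤ᵇ k) (k ∸ 1 ≡ᵇ k') =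
    nsolve 7 (λ a p q r s t u → a ⊠ (p ⊠ q ⊹ (r ⊠ s) ⊠ (t ⊠ u)) ≐ p ⊠ (q ⊠ a) ⊹ (r ⊠ t) ⊠ (s ⊠ (u ⊠ a))) refl
      (A j' k') (χ (j ≡ᵇ j')) (χ (k ≡ᵇ k')) (χ (1 ≤ᵇ j)) (χ (j ∸ 1 ≡ᵇ j')) (χ (1 ≤ᵇ k)) (χ (k ∸ 1 ≡ᵇ k'))

length-filterᵇ-map : ∀ {A B : Set} (P : B → Bool) (g : A → B) xs →
  length (filterᵇ P (map g xs)) ≡ length (filterᵇ (P ∘ g) xs)
length-filterᵇ-map P g [] = refl
length-filterᵇ-map P g (x ∷ xs) with P (g x)
... | true = cong suc (length-filterᵇ-map P g xs)
... | false = length-filterᵇ-map P g xs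

module _ {A : Set} where

  Σ⊆ : (List A → ℕ) → List A → ℕ
  Σ⊆ f [] = f []
  Σ⊆ f (x ∷ L) = Σ⊆ f L + Σ⊆ (λ t → f (x ∷ t)) L

  length-filterᵇ-subsets : ∀ (P : List A → Bool) L →
    length (filterᵇ P (subsets L)) ≡ Σ⊆ (χ ∘ P) L
  length-filterᵇ-subsets P [] with P []
  ... | true = refl
  ... | false = refl
  length-filterᵇ-subsets P (x ∷ L) = begin
    length (filterᵇ P (subsets L ++ map (x ∷_) (subsets L)))
      ≡⟨ cong length (filter-++ _ (subsets L) _) ⟩
    length (filterᵇ P (subsets L) ++ filterᵇ P (map (x ∷_) (subsets L)))
      ≡⟨ length-++ (filterᵇ P (subsets L)) ⟩
    length (filterᵇ P (subsets L)) + length (filterᵇ P (map (x ∷_) (subsets L)))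
      ≡⟨ cong₂ _+_ (length-filterᵇ-subsets P L)
           (trans (length-filterᵇ-map P (x ∷_) (subsets L)) (length-filterᵇ-subsets (λ t → P (x ∷ t)) L)) ⟩
    Σ⊆ (χ ∘ P) (x ∷ L) ∎
    where open ≡-Reasoning

  Σ⊆-cong : ∀ {f g : List A → ℕ} L → (∀ t → f t ≡ g t) → Σ⊆ f L ≡ Σ⊆ g L
  Σ⊆-cong [] e = e []
  Σ⊆-cong (x ∷ L) e = cong₂ _+_ (Σ⊆-cong L e) (Σ⊆-cong L (λ t → e (x ∷ t)))

  Σ⊆-cong-on : ∀ {S : A → Set} {f g : List A → ℕ} L → All S L →
    (∀ t → All S t → f t ≡ g t) → Σ⊆ f L ≡ Σ⊆ g L
  Σ⊆-cong-on [] _ e = e [] []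
  Σ⊆-cong-on (x ∷ L) (px ∷ pL) e =
    cong₂ _+_ (Σ⊆-cong-on L pL e) (Σ⊆-cong-on L pL (λ t pt → e (x ∷ t) (px ∷ pt)))

  Σ⊆-+ : ∀ (f g : List A → ℕ) L → Σ⊆ (λ t → f t + g t) L ≡ Σ⊆ f L + Σ⊆ g L
  Σ⊆-+ f g [] = refl
  Σ⊆-+ f g (x ∷ L) = trans (cong₂ _+_ (Σ⊆-+ f g L) (Σ⊆-+ _ _ L))
    (+-interchange (Σ⊆ f L) (Σ⊆ g L) _ _)

  Σ⊆-*ˡ : ∀ c (f : List A → ℕ) L → Σ⊆ (λ t → c * f t) L ≡ c * Σ⊆ f L
  Σ⊆-*ˡ c f [] = refl
  Σ⊆-*ˡ c f (x ∷ L) = trans (cong₂ _+_ (Σ⊆-*ˡ c f L) (Σ⊆-*ˡ c _ L)) (sym (*-distribˡ-+ c _ _))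

  Σ⊆-0 : ∀ L → Σ⊆ (λ _ → 0) L ≡ 0
  Σ⊆-0 [] = refl
  Σ⊆-0 (x ∷ L) = cong₂ _+_ (Σ⊆-0 L) (Σ⊆-0 L)

  Σ⊆-Σℕ : ∀ n (f : ℕ → List A → ℕ) L → Σ⊆ (λ t → Σℕ n (λ i → f i t)) L ≡ Σℕ n (λ i → Σ⊆ (f i) L)
  Σ⊆-Σℕ zero f L = refl
  Σ⊆-Σℕ (suc n) f L = trans (Σ⊆-+ _ _ L) (cong (_+ Σ⊆ (f (suc n)) L) (Σ⊆-Σℕ n f L))

  Σ⊆-map : ∀ (g : A → A) (f : List A → ℕ) L → Σ⊆ f (map g L) ≡ Σ⊆ (f ∘ map g) L
  Σ⊆-map g f [] = refl
  Σ⊆-map g f (x ∷ L) = cong₂ _+_ (Σ⊆-map g f L) (Σ⊆-map g _ L)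

  SwapInvariant : (List A → ℕ) → Set
  SwapInvariant f = ∀ u x y t → f (u ++ x ∷ y ∷ t) ≡ f (u ++ y ∷ x ∷ t)

  SwapInvariant-∷ : ∀ {f} z → SwapInvariant f → SwapInvariant (λ t → f (z ∷ t))
  SwapInvariant-∷ z i u x y t = i (z ∷ u) x y t

  Σ⊆-swap : ∀ f → SwapInvariant f → ∀ x y L → Σ⊆ f (x ∷ y ∷ L) ≡ Σ⊆ f (y ∷ x ∷ L)
  Σ⊆-swap f i x y L =
    trans (cong (λ w → (Σ⊆ f L + Σ⊆ (λ t → f (y ∷ t)) L) + (Σ⊆ (λ t → f (x ∷ t)) L + w))
            (Σ⊆-cong L (λ t → i [] x y t)))
      (+-interchange (Σ⊆ f L) _ _ _)

  Σ⊆-move : ∀ f → SwapInvariant f → ∀ x L Cs → Σ⊆ f (L ++ x ∷ Cs) ≡ Σ⊆ f (x ∷ L ++ Cs)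
  Σ⊆-move f i x [] Cs = refl
  Σ⊆-move f i x (y ∷ L) Cs =
    trans (cong₂ _+_ (Σ⊆-move f i x L Cs) (Σ⊆-move (λ t → f (y ∷ t)) (SwapInvariant-∷ {f} y i) x L Cs))
      (sym (Σ⊆-swap f i x y (L ++ Cs)))

Σ⊆-filter : ∀ {A : Set} (f : List A → ℕ) (q : A → Bool) L →
  (∀ u y t → q y ≡ false → f (u ++ y ∷ t) ≡ 0) → Σ⊆ f L ≡ Σ⊆ f (filterᵇ q L)
Σ⊆-filter f q [] h = refl
Σ⊆-filter f q (x ∷ L) h with q x in eq
... | true = cong₂ _+_ (Σ⊆-filter f q L h) (Σ⊆-filter (λ t → f (x ∷ t)) q L (λ u y t e → h (x ∷ u) y t e))
... | false = trans (cong (_+_ (Σ⊆ f L)) (trans (Σ⊆-cong L (λ t → h [] x t eq)) (Σ⊆-0 L)))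
   (trans (+-identityʳ _) (Σ⊆-filter f q L h))

Σ⊆-++-product : ∀ {A : Set} (F : List A → ℕ) (G H : ℕ → ℕ → List A → ℕ) a b {SA SC : A → Set} →
  (∀ w t → All SA w → All SC t → F (w ++ t) ≡ Σℕ a (λ j → Σℕ b (λ k → G j k w * H j k t))) →
  ∀ As Cs u → All SA u → All SA As → All SC Cs →
  Σ⊆ (λ t → F (u ++ t)) (As ++ Cs) ≡ Σℕ a (λ j → Σℕ b (λ k → Σ⊆ (λ s → G j k (u ++ s)) As * Σ⊆ (H j k) Cs))
Σ⊆-++-product F G H a b {SA} {SC} hyp [] Cs u au aA aC =
  trans (Σ⊆-cong-on Cs aC (λ t at → hyp u t au at))
  (trans (Σ⊆-Σℕ a _ Cs) (Σℕ-cong a (λ j → trans (Σ⊆-Σℕ b _ Cs) (Σℕ-cong b (λ k →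
     trans (Σ⊆-*ˡ (G j k u) (H j k) Cs) (cong (λ z → G j k z * Σ⊆ (H j k) Cs) (sym (++-identityʳ u))))))))
Σ⊆-++-product F G H a b {SA} {SC} hyp (x ∷ As) Cs u au (ax ∷ aA) aC =
  trans (cong₂ _+_ (Σ⊆-++-product F G H a b hyp As Cs u au aA aC)
     (trans (Σ⊆-cong (As ++ Cs) (λ t → cong F (sym (++-assoc u [ x ] t))))
       (Σ⊆-++-product F G H a b hyp As Cs (u ++ [ x ]) (++⁺ au (ax ∷ [])) aA aC)))
  (trans (sym (Σℕ-+ a _ _)) (Σℕ-cong a (λ j → trans (sym (Σℕ-+ b _ _)) (Σℕ-cong b (λ k →
     trans (sym (*-distribʳ-+ (Σ⊆ (H j k) Cs) (Σ⊆ (λ s → G j k (u ++ s)) As) (Σ⊆ (λ s → G j k ((u ++ [ x ]) ++ s)) As)))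
       (cong (λ z → (Σ⊆ (λ s → G j k (u ++ s)) As + z) * Σ⊆ (H j k) Cs)
          (Σ⊆-cong As (λ s → cong (G j k) (++-assoc u [ x ] s)))))))))

Σ⊆-length : ∀ {A : Set} (L : List A) c j → Σ⊆ (λ s → χ (c + length s ≡ᵇ j)) L ≡ χ (c ≤ᵇ j) * (length L C (j ∸ c))
Σ⊆-length [] c j with c ≟ j
... | yes refl rewrite +-identityʳ c | ≡ᵇ-true {c} refl | ≤ᵇ-true {c} ≤-refl | n∸n≡0 c = refl
... | no ne rewrite +-identityʳ c | ≡ᵇ-false ne with c ≤? j
...   | no nle rewrite ≤ᵇ-false nle = refl
...   | yes le rewrite ≤ᵇ-true le with j ∸ c in e
...     | zero = ⊥-elim (ne (≤-antisym le (m∸n≡0⇒m≤n e)))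
...     | suc _ = refl
Σ⊆-length (x ∷ L) c j =
  trans (cong₂ _+_ (Σ⊆-length L c j) (trans (Σ⊆-cong L (λ s → cong (λ z → χ (z ≡ᵇ j)) (+-suc c (length s)))) (Σ⊆-length L (suc c) j)))
   (step (length L))
  where
  step : ∀ n → χ (c ≤ᵇ j) * (n C (j ∸ c)) + χ (suc c ≤ᵇ j) * (n C (j ∸ suc c)) ≡ χ (c ≤ᵇ j) * (suc n C (j ∸ c))
  step n with <-cmp c j
  ... | tri< lt _ _ rewrite ≤ᵇ-true (<⇒≤ lt) | ≤ᵇ-true lt | +-∸-assoc 1 lt =
     trans (cong₂ _+_ (+-identityʳ (n C suc d)) (+-identityʳ (n C d)))
       (trans (+-comm (n C suc d) (n C d)) (trans (nCk+nC[k+1]≡[n+1]C[k+1] n d) (sym (+-identityʳ _))))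
    where
    d : ℕ
    d = j ∸ suc c
  ... | tri≈ _ refl _ rewrite ≤ᵇ-true {c} ≤-refl | ≤ᵇ-false {suc c} {c} (<⇒≱ ≤-refl) | n∸n≡0 c = refl
  ... | tri> _ _ gt rewrite ≤ᵇ-false (<⇒≱ gt) | ≤ᵇ-false {suc c} {j} (<⇒≱ (m<n⇒m<1+n gt)) = refl

module _ {A : Set} where
  all-++ : ∀ (f : A → Bool) u v → all f (u ++ v) ≡ all f u ∧ all f v
  all-++ f [] v = refl
  all-++ f (x ∷ u) v with f x
  ... | true = all-++ f u v
  ... | false = refl

  all-true : ∀ {f : A → Bool} {u} → All (λ x → f x ≡ true) u → all f u ≡ true
  all-true [] = refl
  all-true (e ∷ es) rewrite e = all-true es

  all-cong-on : ∀ {S : A → Set} {f g : A → Bool} {u} → All S u → (∀ x → S x → f x ≡ g x) → all f u ≡ all g u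
  all-cong-on [] e = refl
  all-cong-on {u = x ∷ u} (s ∷ ss) e = cong₂ _∧_ (e x s) (all-cong-on ss e)

  all-false-∈ : ∀ {f : A → Bool} {y} {u} → y ∈ u → f y ≡ false → all f u ≡ false
  all-false-∈ {f} {u = x ∷ u} (here refl) e rewrite e = refl
  all-false-∈ {f} {u = x ∷ u} (there m) e rewrite all-false-∈ {f} m e = ∧-zeroʳ (f x)

all-map : ∀ {A : Set} (f : A → Bool) (g : A → A) u → all f (map g u) ≡ all (f ∘ g) u
all-map f g [] = refl
all-map f g (x ∷ u) = cong (f (g x) ∧_) (all-map f g u)

all-cong : ∀ {A : Set} {f g : A → Bool} u → (∀ x → f x ≡ g x) → all f u ≡ all g u
all-cong [] e = refl
all-cong (x ∷ u) e = cong₂ _∧_ (e x) (all-cong u e)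

all-swap : ∀ {A : Set} (f : A → Bool) u x y t → all f (u ++ x ∷ y ∷ t) ≡ all f (u ++ y ∷ x ∷ t)
all-swap f [] x y t = trans (sym (∧-assoc (f x) (f y) _)) (trans (cong (_∧ all f t) (∧-comm (f x) (f y))) (∧-assoc (f y) (f x) _))
all-swap f (z ∷ u) x y t = cong (f z ∧_) (all-swap f u x y t)

any-++ : ∀ {A : Set} (f : A → Bool) u v → any f (u ++ v) ≡ any f u ∨ any f v
any-++ f [] v = refl
any-++ f (x ∷ u) v with f x
... | true = refl
... | false = any-++ f u v

any-false : ∀ {A : Set} {S : A → Set} {f : A → Bool} {u} → All S u → (∀ x → S x → f x ≡ false) → any f u ≡ false
any-false [] e = refl
any-false {u = x ∷ u} (s ∷ ss) e rewrite e x s = any-false ss e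

any-cong : ∀ {A : Set} {f g : A → Bool} u → (∀ x → f x ≡ g x) → any f u ≡ any g u
any-cong [] e = refl
any-cong (x ∷ u) e = cong₂ _∨_ (e x) (any-cong u e)

any-map : ∀ {A : Set} (f : A → Bool) (g : A → A) u → any f (map g u) ≡ any (f ∘ g) u
any-map f g [] = refl
any-map f g (x ∷ u) = cong (f (g x) ∨_) (any-map f g u)

any-swap : ∀ {A : Set} (f : A → Bool) u x y t → any f (u ++ x ∷ y ∷ t) ≡ any f (u ++ y ∷ x ∷ t)
any-swap f [] x y t = trans (sym (∨-assoc (f x) (f y) _)) (trans (cong (_∨ any f t) (∨-comm (f x) (f y))) (∨-assoc (f y) (f x) _))
any-swap f (z ∷ u) x y t = cong (f z ∨_) (any-swap f u x y t)

length-swap : ∀ {A : Set} (u : List A) x y t → length (u ++ x ∷ y ∷ t) ≡ length (u ++ y ∷ x ∷ t)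
length-swap [] x y t = refl
length-swap (z ∷ u) x y t = cong suc (length-swap u x y t)

filterᵇ-all : ∀ {A : Set} {q : A → Bool} {L} → All (λ x → q x ≡ true) L → filterᵇ q L ≡ L
filterᵇ-all [] = refl
filterᵇ-all {q = q} {x ∷ L} (e ∷ es) with q x | e
... | true | refl = cong (x ∷_) (filterᵇ-all es)

filterᵇ-none : ∀ {A : Set} {q : A → Bool} {L} → All (λ x → q x ≡ false) L → filterᵇ q L ≡ []
filterᵇ-none [] = refl
filterᵇ-none {q = q} {x ∷ L} (e ∷ es) with q x | e
... | false | refl = filterᵇ-none es

upFrom : ℕ → ℕ → List ℕ
upFrom a zero = []
upFrom a (suc k) = a ∷ upFrom (suc a) k

All-upFrom : ∀ a k → All (λ r → a ≤ r × r < a + k) (upFrom a k)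
All-upFrom a zero = []
All-upFrom a (suc k) = (≤-refl , subst (a <_) (sym (+-suc a k)) (s≤s (m≤m+n a k)))
  ∷ All.map (λ { {r} (p , q) → <⇒≤ p , subst (r <_) (sym (+-suc a k)) q }) (All-upFrom (suc a) k)

All-map-upFrom : ∀ {A : Set} {S : A → Set} (f : ℕ → A) a k → (∀ r → a ≤ r → r < a + k → S (f r)) → All S (map f (upFrom a k))
All-map-upFrom f a zero h = []
All-map-upFrom f a (suc k) h = h a ≤-refl (subst (a <_) (sym (+-suc a k)) (s≤s (m≤m+n a k)))
  ∷ All-map-upFrom f (suc a) k (λ r le lt → h r (<⇒≤ le) (subst (r <_) (sym (+-suc a k)) lt))

∈-upFrom : ∀ {t} a k → a ≤ t → t < a + k → t ∈ upFrom a k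
∈-upFrom a zero le lt = ⊥-elim (<⇒≱ lt (subst (_≤ _) (sym (+-identityʳ a)) le))
∈-upFrom {t} a (suc k) le lt with t ≟ a
... | yes refl = here refl
... | no ne = there (∈-upFrom (suc a) k (≤∧≢⇒< le (λ e → ne (sym e))) (subst (t <_) (+-suc a k) lt))

upFrom-suc : ∀ a k → upFrom (suc a) k ≡ map suc (upFrom a k)
upFrom-suc a zero = refl
upFrom-suc a (suc k) = cong (suc a ∷_) (upFrom-suc (suc a) k)

upFrom-∷ʳ : ∀ a k → upFrom a (suc k) ≡ upFrom a k ++ [ a + k ]
upFrom-∷ʳ a zero = cong [_] (sym (+-identityʳ a))
upFrom-∷ʳ a (suc k) = cong (a ∷_) (trans (upFrom-∷ʳ (suc a) k) (cong (λ x → upFrom (suc a) k ++ [ x ]) (sym (+-suc a k))))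

upFrom-+ : ∀ a k l → upFrom a (k + l) ≡ upFrom a k ++ upFrom (a + k) l
upFrom-+ a zero l = cong (λ x → upFrom x l) (sym (+-identityʳ a))
upFrom-+ a (suc k) l = cong (a ∷_) (trans (upFrom-+ (suc a) k l) (cong (λ x → upFrom (suc a) k ++ upFrom x l) (sym (+-suc a k))))

applyUpTo≡upFrom : ∀ k a (h : ℕ → ℕ) → (∀ t → h t ≡ a + t) → applyUpTo h k ≡ upFrom a k
applyUpTo≡upFrom zero a h e = refl
applyUpTo≡upFrom (suc k) a h e = cong₂ _∷_ (trans (e 0) (+-identityʳ a))
  (applyUpTo≡upFrom k (suc a) (h ∘ suc) (λ t → trans (e (suc t)) (+-suc a t)))

map-applyUpTo : ∀ {A C : Set} (f : A → C) (g : ℕ → A) k → map f (applyUpTo g k) ≡ applyUpTo (f ∘ g) k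
map-applyUpTo f g zero = refl
map-applyUpTo f g (suc k) = cong (f (g 0) ∷_) (map-applyUpTo f (g ∘ suc) k)

range≡upFrom : ∀ a b → range a b ≡ upFrom a (suc b ∸ a)
range≡upFrom a b = trans (map-applyUpTo (_+_ a) (λ x → x) (suc b ∸ a)) (applyUpTo≡upFrom _ a (_+_ a) (λ t → refl))

all-range-true : ∀ {f : ℕ → Bool} a b → a ≤ suc b → (∀ t → a ≤ t → t ≤ b → f t ≡ true) → all f (range a b) ≡ true
all-range-true {f} a b ab h rewrite range≡upFrom a b =
  all-true (All.map (λ { {t} (p , q) → h t p (≤-pred (subst (t <_) (m+[n∸m]≡n ab) q)) }) (All-upFrom a (suc b ∸ a)))

all-range-false : ∀ {f : ℕ → Bool} a b t → a ≤ t → t ≤ b → f t ≡ false → all f (range a b) ≡ false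
all-range-false {f} a b t p q e rewrite range≡upFrom a b =
  all-false-∈ {f = f} (∈-upFrom a (suc b ∸ a) p (subst (t <_) (sym (m+[n∸m]≡n (≤-trans p (m≤n⇒m≤1+n q)))) (s≤s q))) e

filterᵇ-single : ∀ {A : Set} (q : A → Bool) (f : ℕ → A) a k v → a ≤ v → v < a + k →
  (∀ t → a ≤ t → t < a + k → q (f t) ≡ (t ≡ᵇ v)) → filterᵇ q (map f (upFrom a k)) ≡ [ f v ]
filterᵇ-single q f a zero v le lt h = ⊥-elim (<⇒≱ lt (subst (_≤ v) (sym (+-identityʳ a)) le))
filterᵇ-single q f a (suc k) v le lt h with a ≟ v
... | yes refl rewrite h a ≤-refl (subst (a <_) (sym (+-suc a k)) (s≤s (m≤m+n a k))) | ≡ᵇ-true {a} refl =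
  cong (f a ∷_) (filterᵇ-none (All-map-upFrom {S = λ c → q c ≡ false} f (suc a) k
    (λ r le' lt' → trans (h r (<⇒≤ le') (subst (r <_) (sym (+-suc a k)) lt')) (≡ᵇ-false (>⇒≢ le')))))
... | no ne rewrite h a ≤-refl (subst (a <_) (sym (+-suc a k)) (s≤s (m≤m+n a k))) | ≡ᵇ-false ne =
  filterᵇ-single q f (suc a) k v (≤∧≢⇒< le ne) (subst (v <_) (+-suc a k) lt)
    (λ t le' lt' → h t (<⇒≤ le') (subst (t <_) (sym (+-suc a k)) lt'))

countᵇ : (ℕ → Bool) → List ℕ → ℕ
countᵇ f L = length (filterᵇ f L)

countᵇ-++ : ∀ f u v → countᵇ f (u ++ v) ≡ countᵇ f u + countᵇ f v
countᵇ-++ f u v = trans (cong length (filter-++ _ u v)) (length-++ (filterᵇ f u))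

countᵇ-cong : ∀ {f g} L → (∀ r → f r ≡ g r) → countᵇ f L ≡ countᵇ g L
countᵇ-cong [] e = refl
countᵇ-cong {f} {g} (x ∷ L) e with f x | g x | e x
... | true | .true | refl = cong suc (countᵇ-cong L e)
... | false | .false | refl = countᵇ-cong L e

countᵇ-0 : ∀ {S : ℕ → Set} {f} L → All S L → (∀ r → S r → f r ≡ false) → countᵇ f L ≡ 0
countᵇ-0 [] _ e = refl
countᵇ-0 {f = f} (x ∷ L) (s ∷ ss) e with f x | e x s
... | false | refl = countᵇ-0 L ss e

countᵇ-∨ : ∀ f g L → (∀ r → f r ∧ g r ≡ false) → countᵇ (λ r → f r ∨ g r) L ≡ countᵇ f L + countᵇ g L
countᵇ-∨ f g [] d = refl
countᵇ-∨ f g (x ∷ L) d with f x | g x | d x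
... | true | true | ()
... | true | false | _ = cong suc (countᵇ-∨ f g L d)
... | false | true | _ = trans (cong suc (countᵇ-∨ f g L d)) (sym (+-suc _ _))
... | false | false | _ = countᵇ-∨ f g L d

countᵇ-≡ᵇ-outside : ∀ v a k → v < a → countᵇ (λ r → v ≡ᵇ r) (upFrom a k) ≡ 0
countᵇ-≡ᵇ-outside v a k lt =
  countᵇ-0 (upFrom a k) (All-upFrom a k) (λ r p → ≡ᵇ-false (λ e → <⇒≱ lt (subst (a ≤_) (sym e) (proj₁ p))))

countᵇ-≡ᵇ-inside : ∀ v a k → a ≤ v → v < a + k → countᵇ (λ r → v ≡ᵇ r) (upFrom a k) ≡ 1
countᵇ-≡ᵇ-inside v a zero le lt = ⊥-elim (<⇒≱ lt (subst (_≤ v) (sym (+-identityʳ a)) le))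
countᵇ-≡ᵇ-inside v a (suc k) le lt with v ≟ a
... | yes refl rewrite ≡ᵇ-true {v} refl = cong suc (countᵇ-≡ᵇ-outside v (suc v) k ≤-refl)
... | no ne rewrite ≡ᵇ-false ne =
  countᵇ-≡ᵇ-inside v (suc a) k (≤∧≢⇒< le (λ e → ne (sym e))) (subst (v <_) (+-suc a k) lt)

rowCells : ℕ → ℕ → ℕ → List Cell
rowCells i a k = map (λ j → (i , j)) (upFrom a k)

columnCells : ℕ → ℕ → ℕ → List Cell
columnCells m a k = map (λ i → (i , m)) (upFrom a k)

row1Desc : ℕ → List Cell
row1Desc zero = []
row1Desc (suc k) = (1 , suc k) ∷ row1Desc k

shiftedB : ℕ → ℕ → List Cell
shiftedB c zero = []
shiftedB c (suc n) = rowCells (suc c) (suc c) (suc n) ++ shiftedB (suc c) n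

shiftCell : Cell → Cell
shiftCell (i , j) = (suc i , suc j)

rowOfB : ℕ → ℕ → List Cell
rowOfB N i = map (λ j → (i , j)) (range i N)

concat-rows≡shiftedB : ∀ N n c → c + n ≡ N → concat (map (rowOfB N) (upFrom (suc c) n)) ≡ shiftedB c n
concat-rows≡shiftedB N zero c e = refl
concat-rows≡shiftedB N (suc n) c e = cong₂ _++_ row (concat-rows≡shiftedB N n (suc c) (trans (sym (+-suc c n)) e))
  where
  row : rowOfB N (suc c) ≡ rowCells (suc c) (suc c) (suc n)
  row = cong (map (λ j → (suc c , j))) (trans (range≡upFrom (suc c) N)
          (cong (upFrom (suc c)) (trans (cong (_∸ c) (sym e)) (m+n∸m≡n c (suc n)))))

B≡shiftedB : ∀ N → B N ≡ shiftedB 0 N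
B≡shiftedB N = trans (cong (λ L → concat (map (rowOfB N) L)) (range≡upFrom 1 N)) (concat-rows≡shiftedB N N 0 refl)

map-shiftCell-rowCells : ∀ i a k → map shiftCell (rowCells i a k) ≡ rowCells (suc i) (suc a) k
map-shiftCell-rowCells i a zero = refl
map-shiftCell-rowCells i a (suc k) = cong ((suc i , suc a) ∷_) (map-shiftCell-rowCells i (suc a) k)

map-shiftCell-shiftedB : ∀ c n → map shiftCell (shiftedB c n) ≡ shiftedB (suc c) n
map-shiftCell-shiftedB c zero = refl
map-shiftCell-shiftedB c (suc n) = trans (map-++ shiftCell (rowCells (suc c) (suc c) (suc n)) (shiftedB (suc c) n))
  (cong₂ _++_ (map-shiftCell-rowCells (suc c) (suc c) (suc n)) (map-shiftCell-shiftedB (suc c) n))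

rowCells-∷ʳ : ∀ i a k → rowCells i a (suc k) ≡ rowCells i a k ++ [ (i , a + k) ]
rowCells-∷ʳ i a k = trans (cong (map (λ j → (i , j))) (upFrom-∷ʳ a k)) (map-++ _ (upFrom a k) [ a + k ])

columnCells-∷ʳ : ∀ m a k → columnCells m a (suc k) ≡ columnCells m a k ++ [ (a + k , m) ]
columnCells-∷ʳ m a k = trans (cong (map (λ i → (i , m))) (upFrom-∷ʳ a k)) (map-++ _ (upFrom a k) [ a + k ])

InB : ℕ → Cell → Set
InB N c = 1 ≤ proj₁ c × proj₁ c ≤ proj₂ c × proj₂ c ≤ N

InShiftedB : ℕ → ℕ → Cell → Set
InShiftedB c n x = suc c ≤ proj₁ x × proj₁ x ≤ proj₂ x × proj₂ x ≤ c + n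

All-shiftedB : ∀ c n → All (InShiftedB c n) (shiftedB c n)
All-shiftedB c zero = []
All-shiftedB c (suc n) = ++⁺
  (All-map-upFrom (λ j → (suc c , j)) (suc c) (suc n) (λ r le lt → ≤-refl , le , ≤-pred lt))
  (All.map {P = InShiftedB (suc c) n} {Q = InShiftedB c (suc n)}
     (λ { {x} (p , q , r) → <⇒≤ p , q , subst (proj₂ x ≤_) (sym (+-suc c n)) r }) (All-shiftedB (suc c) n))

All-row1Desc : ∀ M → All (λ c → proj₁ c ≡ 1 × 1 ≤ proj₂ c × proj₂ c ≤ M) (row1Desc M)
All-row1Desc zero = []
All-row1Desc (suc M) = (refl , s≤s z≤n , ≤-refl) ∷ All.map (λ { (p , q , r) → p , q , m≤n⇒m≤1+n r }) (All-row1Desc M)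

All-columnCells : ∀ m a k → All (λ c → proj₂ c ≡ m × a ≤ proj₁ c × proj₁ c < a + k) (columnCells m a k)
All-columnCells m a k = All-map-upFrom (λ i → (i , m)) a k (λ r le lt → refl , le , lt)

-- Inside B_N the rectangle condition of `nested` reduces to k ≤ j.
nestedInB : Cell → Cell → Bool
nestedInB (i , j) (k , l) = (i <ᵇ k) ∧ (j <ᵇ l) ∧ (k ≤ᵇ j)

adjacent : Cell → Cell → Bool
adjacent p q = not (cellEq p q) ∧ (crossing p q ∨ crossing q p ∨ nestedInB p q ∨ nestedInB q p)

compatible : Cell → Cell → Bool
compatible p q = not (adjacent p q)

rectInB-inside : ∀ N i j k l → 1 ≤ i → i < k → j < l → l ≤ N → rectInB N (i , j) (k , l) ≡ (k ≤ᵇ j)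
rectInB-inside N i j k l h1 ik jl lN with k ≤? j
... | yes kj rewrite ≤ᵇ-true kj = all-range-true i k (m≤n⇒m≤1+n (<⇒≤ ik))
  (λ r ir rk → all-range-true j l (m≤n⇒m≤1+n (<⇒≤ jl))
     (λ c jc cl → cong₂ _∧_ (≤ᵇ-true (≤-trans h1 ir))
                      (cong₂ _∧_ (≤ᵇ-true (≤-trans rk (≤-trans kj jc))) (≤ᵇ-true (≤-trans cl lN)))))
... | no nkj rewrite ≤ᵇ-false nkj = all-range-false i k k (<⇒≤ ik) ≤-refl
  (all-range-false j l j ≤-refl (<⇒≤ jl) (trans (cong (λ z → (1 ≤ᵇ k) ∧ z) (cong (_∧ (j ≤ᵇ N)) (≤ᵇ-false nkj))) (∧-zeroʳ _)))

nested≡nestedInB : ∀ N p q → InB N p → InB N q → nested N p q ≡ nestedInB p q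
nested≡nestedInB N (i , j) (k , l) (h1 , _ , _) (_ , _ , lN) with i <ᵇ k in e1
... | false = refl
... | true with j <ᵇ l in e2
... | false = refl
... | true = rectInB-inside N i j k l h1 (<ᵇ⇒< i k (subst T (sym e1) _)) (<ᵇ⇒< j l (subst T (sym e2) _)) lN

adjUD≡adjacent : ∀ N p q → InB N p → InB N q → adjUD N p q ≡ adjacent p q
adjUD≡adjacent N p q bp bq rewrite nested≡nestedInB N p q bp bq | nested≡nestedInB N q p bq bp = refl

compatible-shiftCell : ∀ p q → compatible (shiftCell p) (shiftCell q) ≡ compatible p q
compatible-shiftCell (i , j) (k , l) rewrite <ᵇ-suc k j | <ᵇ-suc i l = refl

compatible-separated : ∀ i j k l → i ≤ j → j < k → k ≤ l → (compatible (i , j) (k , l) ≡ true) × (compatible (k , l) (i , j) ≡ true)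
compatible-separated i j k l ij jk kl
  rewrite ≡ᵇ-false {i} {k} (<⇒≢ (≤-<-trans ij jk))
        | ≡ᵇ-false {k} {i} (>⇒≢ (≤-<-trans ij jk))
        | <ᵇ-false {k} {i} (≤⇒≯ (<⇒≤ (≤-<-trans ij jk))) | <ᵇ-true {j} {l} (<-≤-trans jk kl)
        | <ᵇ-true {i} {k} (≤-<-trans ij jk) | <ᵇ-false {l} {j} (≤⇒≯ (<⇒≤ (<-≤-trans jk kl)))
        | ≤ᵇ-false {k} {j} (<⇒≱ jk) = refl , refl

compatible-row1 : ∀ m j → compatible (1 , m) (1 , j) ≡ true
compatible-row1 m j = cong not (∧-zeroʳ _)

compatible-sameColumn : ∀ r r' c → compatible (r , c) (r' , c) ≡ true
compatible-sameColumn r r' c rewrite n<ᵇn c with r <ᵇ r' | r' <ᵇ r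
... | true | true = cong not (∧-zeroʳ _)
... | true | false = cong not (∧-zeroʳ _)
... | false | true = cong not (∧-zeroʳ _)
... | false | false = cong not (∧-zeroʳ _)

compatible-diagonal : ∀ i j c → i ≤ j → j ≤ c → (compatible (i , j) (c , c) ≡ true) × (compatible (c , c) (i , j) ≡ true)
compatible-diagonal i j c ij jc with m≤n⇒m<n∨m≡n jc
... | inj₁ lt = compatible-separated i j c c ij lt ≤-refl
... | inj₂ refl = compatible-sameColumn i j j , compatible-sameColumn j i j

compatible-1m : ∀ m r l → 2 ≤ r → r ≤ m → compatible (1 , m) (r , l) ≡ (l ≡ᵇ m)
compatible-1m m r l r2 rm with <-cmp l m
... | tri< lt _ _ rewrite ≡ᵇ-false {1} {r} (<⇒≢ r2) | <ᵇ-false {r} {1} (≤⇒≯ (≤-trans (s≤s z≤n) r2)) | <ᵇ-true {1} {r} r2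
   | <ᵇ-true {l} {m} lt | ≡ᵇ-false {l} {m} (<⇒≢ lt) = refl
... | tri≈ _ refl _ rewrite ≡ᵇ-false {1} {r} (<⇒≢ r2) | <ᵇ-false {r} {1} (≤⇒≯ (≤-trans (s≤s z≤n) r2)) | <ᵇ-true {1} {r} r2
   | <ᵇ-false {l} {l} (n≮n l) | ≡ᵇ-true {l} {l} refl = refl
... | tri> _ _ gt rewrite ≡ᵇ-false {1} {r} (<⇒≢ r2) | <ᵇ-false {r} {1} (≤⇒≯ (≤-trans (s≤s z≤n) r2)) | <ᵇ-true {1} {r} r2
   | <ᵇ-false {l} {m} (<⇒≯ gt) | <ᵇ-true {m} {l} gt | ≤ᵇ-true {r} {m} rm | ≡ᵇ-false {l} {m} (>⇒≢ gt) = refl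

compatible-1m-nextColumn : ∀ M t → 2 ≤ t → t ≤ suc (suc M) → compatible (1 , suc M) (t , suc (suc M)) ≡ (t ≡ᵇ suc (suc M))
compatible-1m-nextColumn M t t2 tm with t ≟ suc (suc M)
... | yes refl rewrite <ᵇ-false {suc M} {M} (≤⇒≯ (n≤1+n M)) | <ᵇ-true {M} {suc M} ≤-refl
   | ≤ᵇ-false {suc (suc M)} {suc M} (<⇒≱ ≤-refl) | ≡ᵇ-true {M} refl = refl
... | no ne rewrite ≡ᵇ-false {1} {t} (<⇒≢ t2) | <ᵇ-false {t} {1} (≤⇒≯ (≤-trans (s≤s z≤n) t2)) | <ᵇ-true {1} {t} t2
   | <ᵇ-false {suc M} {M} (≤⇒≯ (n≤1+n M)) | <ᵇ-true {M} {suc M} ≤-refl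
   | ≤ᵇ-true {t} {suc M} (≤-pred (≤∧≢⇒< tm ne)) | ≡ᵇ-false ne = refl

compatible-row1-column : ∀ a r c c' → a < c → a < c' → compatible (1 , a) (r , c) ≡ compatible (1 , a) (r , c')
compatible-row1-column a r c c' lt lt' rewrite ≡ᵇ-false {a} {c} (<⇒≢ lt) | ≡ᵇ-false {a} {c'} (<⇒≢ lt') | <ᵇ-true lt | <ᵇ-true lt'
  | <ᵇ-false {c} {a} (<⇒≯ lt) | <ᵇ-false {c'} {a} (<⇒≯ lt') = refl

compatible-column-row1 : ∀ a r c c' → a < c → a < c' → compatible (r , c) (1 , a) ≡ compatible (r , c') (1 , a)
compatible-column-row1 a r c c' lt lt' rewrite ≡ᵇ-false {c} {a} (>⇒≢ lt) | ≡ᵇ-false {c'} {a} (>⇒≢ lt') | <ᵇ-true lt | <ᵇ-true lt'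
  | <ᵇ-false {c} {a} (<⇒≯ lt) | <ᵇ-false {c'} {a} (<⇒≯ lt') = refl

filterᵇ-shiftedB : ∀ m n c → 1 ≤ c → c ≤ m → m ≤ c + n →
  filterᵇ (compatible (1 , m)) (shiftedB c n) ≡ columnCells m (suc c) (m ∸ c) ++ shiftedB m (c + n ∸ m)
filterᵇ-shiftedB m n c ≤ᵇ-∸ cm mcn with c ≟ m
... | yes refl rewrite n∸n≡0 c | m+n∸m≡n c n =
  filterᵇ-all (All.map (λ { {(k , l)} (p , q , _) → proj₁ (compatible-separated 1 c k l ≤ᵇ-∸ p q) }) (All-shiftedB c n))
filterᵇ-shiftedB m zero c ≤ᵇ-∸ cm mcn | no ne = ⊥-elim (ne (≤-antisym cm (subst (m ≤_) (+-identityʳ c) mcn)))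
filterᵇ-shiftedB m (suc n) c ≤ᵇ-∸ cm mcn | no ne =
  trans (filter-++ _ (rowCells (suc c) (suc c) (suc n)) (shiftedB (suc c) n))
  (trans (cong₂ _++_ rowpart (filterᵇ-shiftedB m n (suc c) (s≤s z≤n) cm' (subst (m ≤_) (+-suc c n) mcn)))
  (trans (cong (λ z → (suc c , m) ∷ columnCells m (suc (suc c)) (m ∸ suc c) ++ shiftedB m z) (cong (_∸ m) (sym (+-suc c n))))
   (cong (λ z → columnCells m (suc c) z ++ shiftedB m (c + suc n ∸ m)) (sym (+-∸-assoc 1 cm')))))
  where
  cm' : suc c ≤ m
  cm' = ≤∧≢⇒< cm ne
  rowpart : filterᵇ (compatible (1 , m)) (rowCells (suc c) (suc c) (suc n)) ≡ [ (suc c , m) ]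
  rowpart = filterᵇ-single (compatible (1 , m)) (λ j → (suc c , j)) (suc c) (suc n) m cm'
    (s≤s mcn)
    (λ t le _ → compatible-1m m (suc c) t (s≤s ≤ᵇ-∸) cm')

isIndependent : List Cell → Bool
isIndependent I = all (λ p → all (λ q → compatible p q) I) I

independent≡isIndependent : ∀ N {I} → All (InB N) I → independent N I ≡ isIndependent I
independent≡isIndependent N {I} aI = all-cong-on aI (λ p bp → all-cong-on aI (λ q bq → cong not (adjUD≡adjacent N p q bp bq)))

isIndependent-++ : ∀ {SA SC : Cell → Set} → (∀ p q → SA p → SC q → (compatible p q ≡ true) × (compatible q p ≡ true)) →
  ∀ {w t} → All SA w → All SC t → isIndependent (w ++ t) ≡ isIndependent w ∧ isIndependent t
isIndependent-++ {SA} {SC} cr {w} {t} aw at =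
  trans (all-++ _ w t) (cong₂ _∧_
    (all-cong-on aw (λ p sp → trans (all-++ (compatible p) w t)
       (trans (cong (all (compatible p) w ∧_) (all-true (All.map (λ sq → proj₁ (cr p _ sp sq)) at))) (∧-identityʳ _))))
    (all-cong-on at (λ p sp → trans (all-++ (compatible p) w t)
       (cong (_∧ all (compatible p) t) (all-true (All.map (λ sq → proj₂ (cr _ p sq sp)) aw))))))

isIndependent-map : ∀ {S : Cell → Set} (g : Cell → Cell) → (∀ p q → S p → S q → compatible (g p) (g q) ≡ compatible p q) →
  ∀ {w} → All S w → isIndependent (map g w) ≡ isIndependent w
isIndependent-map {S} g e {w} aw =
  trans (all-map _ g w)
    (all-cong-on aw (λ p sp → trans (all-map (compatible (g p)) g w) (all-cong-on aw (λ q sq → e p q sp sq))))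

isIndependent-false : ∀ {x y I} → x ∈ I → y ∈ I → compatible x y ≡ false → isIndependent I ≡ false
isIndependent-false {x} {y} {I} xi yi e = all-false-∈ {f = λ p → all (compatible p) I} xi (all-false-∈ {f = compatible x} yi e)

isIndependent-row1 : ∀ I → All (λ c → proj₁ c ≡ 1) I → isIndependent I ≡ true
isIndependent-row1 I a = all-true (All.map (λ { {(.1 , j)} refl → all-true (All.map (λ { {(.1 , l)} refl → compatible-row1 j l }) a) }) a)

occupies : List Cell → ℕ → Bool
occupies I r = any (λ c → proj₁ c ≡ᵇ r) I

rowsOcc≡countᵇ : ∀ N I → rowsOcc N I ≡ countᵇ (occupies I) (upFrom 1 N)
rowsOcc≡countᵇ N I = cong (countᵇ (occupies I)) (range≡upFrom 1 N)

occupies-above : ∀ m {w} → All (λ c → proj₁ c ≤ m) w → ∀ r → m < r → occupies w r ≡ false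
occupies-above m aw r lt = any-false aw (λ c le → ≡ᵇ-false (λ e → <⇒≱ lt (subst (_≤ m) e le)))

occupies-below : ∀ m {t} → All (λ c → m < proj₁ c) t → ∀ r → r ≤ m → occupies t r ≡ false
occupies-below m at r le = any-false at (λ c lt → ≡ᵇ-false (λ e → <⇒≱ lt (subst (_≤ m) (sym e) le)))

occupies-row1 : ∀ x I → All (λ c → proj₁ c ≡ 1) (x ∷ I) → ∀ t → occupies (x ∷ I) t ≡ (1 ≡ᵇ t)
occupies-row1 (.1 , _) [] (refl ∷ []) t = ∨-identityʳ _
occupies-row1 (.1 , _) (y ∷ I) (refl ∷ a) t = trans (cong ((1 ≡ᵇ t) ∨_) (occupies-row1 y I a t)) (∨-idem _)

rowsOcc-++ : ∀ N m {w t} → All (λ c → proj₁ c ≤ m) w → All (λ c → m < proj₁ c) t →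
  rowsOcc N (w ++ t) ≡ rowsOcc N w + rowsOcc N t
rowsOcc-++ N m {w} {t} aw at = begin
  rowsOcc N (w ++ t)                                        ≡⟨ rowsOcc≡countᵇ N (w ++ t) ⟩
  countᵇ (occupies (w ++ t)) (upFrom 1 N)                   ≡⟨ countᵇ-cong (upFrom 1 N) (λ r → any-++ _ w t) ⟩
  countᵇ (λ r → occupies w r ∨ occupies t r) (upFrom 1 N)   ≡⟨ countᵇ-∨ (occupies w) (occupies t) (upFrom 1 N) disjoint ⟩
  countᵇ (occupies w) (upFrom 1 N) + countᵇ (occupies t) (upFrom 1 N)
    ≡⟨ sym (cong₂ _+_ (rowsOcc≡countᵇ N w) (rowsOcc≡countᵇ N t)) ⟩
  rowsOcc N w + rowsOcc N t                                 ∎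
  where
  open ≡-Reasoning
  disjoint : ∀ r → occupies w r ∧ occupies t r ≡ false
  disjoint r with r ≤? m
  ... | yes le rewrite occupies-below m at r le = ∧-zeroʳ _
  ... | no nle rewrite occupies-above m aw r (≰⇒> nle) = refl

occupies-map-shiftCell-1 : ∀ {I} → All (λ c → 1 ≤ proj₁ c) I → occupies (map shiftCell I) 1 ≡ false
occupies-map-shiftCell-1 {I} aI = trans (any-map _ shiftCell I) (any-false aI (λ { (suc i , j) le → refl }))

rowsOcc-shiftCell : ∀ n {I} → All (λ c → 1 ≤ proj₁ c) I → rowsOcc (suc n) (map shiftCell I) ≡ rowsOcc n I
rowsOcc-shiftCell n {I} aI rewrite rowsOcc≡countᵇ (suc n) (map shiftCell I) | occupies-map-shiftCell-1 aI = begin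
  countᵇ (occupies (map shiftCell I)) (upFrom 2 n)      ≡⟨ cong (countᵇ _) (upFrom-suc 1 n) ⟩
  countᵇ (occupies (map shiftCell I)) (map suc (upFrom 1 n)) ≡⟨ length-filterᵇ-map _ suc (upFrom 1 n) ⟩
  countᵇ (occupies (map shiftCell I) ∘ suc) (upFrom 1 n)
    ≡⟨ countᵇ-cong (upFrom 1 n) (λ r → trans (any-map _ shiftCell I) (any-cong I (λ { (i , j) → refl }))) ⟩
  countᵇ (occupies I) (upFrom 1 n)                      ≡⟨ sym (rowsOcc≡countᵇ n I) ⟩
  rowsOcc n I                                           ∎
  where open ≡-Reasoning

rowsOcc-stable : ∀ M N {I} → All (λ c → proj₁ c ≤ M) I → M ≤ N → rowsOcc N I ≡ rowsOcc M I
rowsOcc-stable M N {I} aI le = begin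
  rowsOcc N I                                          ≡⟨ rowsOcc≡countᵇ N I ⟩
  countᵇ (occupies I) (upFrom 1 N)
    ≡⟨ cong (countᵇ (occupies I)) (trans (cong (upFrom 1) (sym (m+[n∸m]≡n le))) (upFrom-+ 1 M (N ∸ M))) ⟩
  countᵇ (occupies I) (upFrom 1 M ++ upFrom (suc M) (N ∸ M)) ≡⟨ countᵇ-++ _ (upFrom 1 M) _ ⟩
  countᵇ (occupies I) (upFrom 1 M) + countᵇ (occupies I) (upFrom (suc M) (N ∸ M))
    ≡⟨ cong (_+_ (countᵇ (occupies I) (upFrom 1 M)))
         (countᵇ-0 (upFrom (suc M) (N ∸ M)) (All-upFrom (suc M) (N ∸ M)) (λ r p → occupies-above M aI r (proj₁ p))) ⟩
  countᵇ (occupies I) (upFrom 1 M) + 0                  ≡⟨ +-identityʳ _ ⟩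
  countᵇ (occupies I) (upFrom 1 M)                      ≡⟨ sym (rowsOcc≡countᵇ M I) ⟩
  rowsOcc M I                                          ∎
  where open ≡-Reasoning

rowsOcc-[] : ∀ N → rowsOcc N [] ≡ 0
rowsOcc-[] N = trans (rowsOcc≡countᵇ N []) (countᵇ-0 (upFrom 1 N) (All-upFrom 1 N) (λ r _ → refl))

rowsOcc-[-] : ∀ N r c → 1 ≤ r → r ≤ N → rowsOcc N [ (r , c) ] ≡ 1
rowsOcc-[-] N r c r1 rN = trans (rowsOcc≡countᵇ N [ (r , c) ]) (trans (countᵇ-cong (upFrom 1 N) (λ t → ∨-identityʳ (r ≡ᵇ t)))
  (countᵇ-≡ᵇ-inside r 1 N r1 (s≤s rN)))

rowsOcc-row1 : ∀ N x I → 1 ≤ N → All (λ c → proj₁ c ≡ 1) (x ∷ I) → rowsOcc N (x ∷ I) ≡ 1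
rowsOcc-row1 N x I n1 a = trans (rowsOcc≡countᵇ N (x ∷ I))
  (trans (countᵇ-cong (upFrom 1 N) (occupies-row1 x I a)) (countᵇ-≡ᵇ-inside 1 1 N ≤-refl (s≤s n1)))

rowsOcc-swap : ∀ N u x y t → rowsOcc N (u ++ x ∷ y ∷ t) ≡ rowsOcc N (u ++ y ∷ x ∷ t)
rowsOcc-swap N u x y t = begin
  rowsOcc N (u ++ x ∷ y ∷ t)                      ≡⟨ rowsOcc≡countᵇ N (u ++ x ∷ y ∷ t) ⟩
  countᵇ (occupies (u ++ x ∷ y ∷ t)) (upFrom 1 N)  ≡⟨ countᵇ-cong (upFrom 1 N) (λ r → any-swap (λ c → proj₁ c ≡ᵇ r) u x y t) ⟩
  countᵇ (occupies (u ++ y ∷ x ∷ t)) (upFrom 1 N)  ≡⟨ sym (rowsOcc≡countᵇ N (u ++ y ∷ x ∷ t)) ⟩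
  rowsOcc N (u ++ y ∷ x ∷ t)                      ∎
  where open ≡-Reasoning

counted : ℕ → ℕ → ℕ → List Cell → Bool
counted N a b I = isIndependent I ∧ ((length I ≡ᵇ a) ∧ (rowsOcc N I ≡ᵇ b))

counted-cong : ∀ N N′ a b I J → isIndependent I ≡ isIndependent J → length I ≡ length J → rowsOcc N I ≡ rowsOcc N′ J →
  counted N a b I ≡ counted N′ a b J
counted-cong N N′ a b I J e₁ e₂ e₃ = cong₂ _∧_ e₁ (cong₂ _∧_ (cong (_≡ᵇ a) e₂) (cong (_≡ᵇ b) e₃))

counted-false : ∀ N a b I → isIndependent I ≡ false → counted N a b I ≡ false
counted-false N a b I e rewrite e = refl

countUD≡Σ⊆ : ∀ N a b → countUD N a b ≡ Σ⊆ (λ I → χ (counted N a b I)) (shiftedB 0 N)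
countUD≡Σ⊆ N a b =
  trans (length-filterᵇ-subsets _ (B N))
  (trans (cong (Σ⊆ _) (B≡shiftedB N))
  (Σ⊆-cong-on (shiftedB 0 N) (All-shiftedB 0 N)
    (λ t at → cong (λ z → χ (z ∧ ((length t ≡ᵇ a) ∧ (rowsOcc N t ≡ᵇ b)))) (independent≡isIndependent N at))))

counted-shiftCell : ∀ n a b {I} → All (λ c → 1 ≤ proj₁ c) I → counted (suc n) a b (map shiftCell I) ≡ counted n a b I
counted-shiftCell n a b {I} aI = counted-cong (suc n) n a b (map shiftCell I) I
  (isIndependent-map {S = λ _ → ⊤} shiftCell (λ p q _ _ → compatible-shiftCell p q) (All.universal _ I))
  (length-map shiftCell I) (rowsOcc-shiftCell n aI)

Σ⊆-counted-shiftedB : ∀ c n a b → Σ⊆ (λ I → χ (counted (c + n) a b I)) (shiftedB c n) ≡ countUD n a b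
Σ⊆-counted-shiftedB zero n a b = sym (countUD≡Σ⊆ n a b)
Σ⊆-counted-shiftedB (suc c) n a b =
  trans (cong (Σ⊆ _) (sym (map-shiftCell-shiftedB c n)))
  (trans (Σ⊆-map shiftCell _ (shiftedB c n))
  (trans (Σ⊆-cong-on (shiftedB c n) (All-shiftedB c n)
           (λ t at → cong χ (counted-shiftCell (c + n) a b (All.map (λ { (c<i , _) → ≤-trans (s≤s z≤n) c<i }) at))))
  (Σ⊆-counted-shiftedB c n a b)))

counted-swap : ∀ N a b u x y t → counted N a b (u ++ x ∷ y ∷ t) ≡ counted N a b (u ++ y ∷ x ∷ t)
counted-swap N a b u x y t = counted-cong N N a b (u ++ x ∷ y ∷ t) (u ++ y ∷ x ∷ t)
  (trans (all-swap _ u x y t) (all-cong (u ++ y ∷ x ∷ t) (λ p → all-swap (compatible p) u x y t)))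
  (length-swap u x y t) (rowsOcc-swap N u x y t)

counted-SwapInvariant : ∀ N a b pre → SwapInvariant (λ t → χ (counted N a b (pre ++ t)))
counted-SwapInvariant N a b pre u x y t = cong χ (trans (cong (counted N a b) (sym (++-assoc pre u (x ∷ y ∷ t))))
  (trans (counted-swap N a b (pre ++ u) x y t) (cong (counted N a b) (++-assoc pre u (y ∷ x ∷ t)))))

Σ⊆-row1-reverse : ∀ (f : List Cell → ℕ) → SwapInvariant f → ∀ K Cs →
  Σ⊆ f (rowCells 1 1 K ++ Cs) ≡ Σ⊆ f (row1Desc K ++ Cs)
Σ⊆-row1-reverse f i zero Cs = refl
Σ⊆-row1-reverse f i (suc K) Cs = begin
  Σ⊆ f (rowCells 1 1 (suc K) ++ Cs)             ≡⟨ cong (λ L → Σ⊆ f (L ++ Cs)) (rowCells-∷ʳ 1 1 K) ⟩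
  Σ⊆ f ((rowCells 1 1 K ++ [ (1 , suc K) ]) ++ Cs) ≡⟨ cong (Σ⊆ f) (++-assoc (rowCells 1 1 K) [ (1 , suc K) ] Cs) ⟩
  Σ⊆ f (rowCells 1 1 K ++ (1 , suc K) ∷ Cs)      ≡⟨ Σ⊆-move f i (1 , suc K) (rowCells 1 1 K) Cs ⟩
  Σ⊆ f ((1 , suc K) ∷ rowCells 1 1 K ++ Cs)      ≡⟨ cong₂ _+_ (Σ⊆-row1-reverse f i K Cs)
                                                     (Σ⊆-row1-reverse _ (SwapInvariant-∷ {f = f} (1 , suc K) i) K Cs) ⟩
  Σ⊆ f (row1Desc (suc K) ++ Cs)                  ∎
  where open ≡-Reasoning

Σ⊆-counted-filter : ∀ N a b pre x (q : Cell → Bool) L → x ∈ pre → (∀ y → q y ≡ false → compatible x y ≡ false) →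
  Σ⊆ (λ t → χ (counted N a b (pre ++ t))) L ≡ Σ⊆ (λ t → χ (counted N a b (pre ++ t))) (filterᵇ q L)
Σ⊆-counted-filter N a b pre x q L xp h = Σ⊆-filter _ q L
  (λ u y t e → cong χ (counted-false N a b (pre ++ u ++ y ∷ t) (isIndependent-false (∈-++⁺ˡ xp) (∈-++⁺ʳ pre (∈-++⁺ʳ u (here refl))) (h y e))))

Σ⊆-counted-product : ∀ N a b m {SA SC : Cell → Set} →
  (∀ p q → SA p → SC q → (compatible p q ≡ true) × (compatible q p ≡ true)) →
  (∀ {c} → SA c → proj₁ c ≤ m) → (∀ {c} → SC c → m < proj₁ c) →
  ∀ As Cs u → All SA u → All SA As → All SC Cs →
  Σ⊆ (λ t → χ (counted N a b (u ++ t))) (As ++ Cs) ≡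
  Σℕ a (λ j → Σℕ b (λ k → Σ⊆ (λ s → χ (counted N j k (u ++ s))) As * Σ⊆ (λ t → χ (counted N (a ∸ j) (b ∸ k) t)) Cs))
Σ⊆-counted-product N a b m {SA} {SC} cr ra rc As Cs u au aA aC =
  Σ⊆-++-product (λ I → χ (counted N a b I)) (λ j k w → χ (counted N j k w)) (λ j k t → χ (counted N (a ∸ j) (b ∸ k) t)) a b
    (λ w t aw at → trans (cong χ (cong₂ _∧_ (isIndependent-++ cr aw at)
       (cong₂ _∧_ (cong (_≡ᵇ a) (length-++ w)) (cong (_≡ᵇ b) (rowsOcc-++ N m (All.map ra aw) (All.map rc at))))))
       (χ-convolution (isIndependent w) (isIndependent t) (length w) (length t) (rowsOcc N w) (rowsOcc N t) a b))
    As Cs u au aA aC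

Σ⊆-[-] : ∀ N c x y → 1 ≤ proj₁ c → proj₁ c ≤ N →
  Σ⊆ (λ t → χ (counted N x y t)) [ c ] ≡ cellWeight x y
Σ⊆-[-] N (r , l) x y r1 rN rewrite rowsOcc-[] N | rowsOcc-[-] N r l r1 rN | ≡ᵇ-true {r} refl | ≡ᵇ-true {l} refl = refl

length-row1Desc : ∀ K → length (row1Desc K) ≡ K
length-row1Desc zero = refl
length-row1Desc (suc K) = cong suc (length-row1Desc K)

Σ⊆-row1Desc : ∀ N j k x u K → 1 ≤ N → All (λ c → proj₁ c ≡ 1) (x ∷ u) →
  Σ⊆ (λ s → χ (counted N j k ((x ∷ u) ++ s))) (row1Desc K) ≡
  χ (1 ≡ᵇ k) * (χ (suc (length u) ≤ᵇ j) * (K C (j ∸ suc (length u))))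
Σ⊆-row1Desc N j k x u K 1≤N row1 = begin
  Σ⊆ (λ s → χ (counted N j k ((x ∷ u) ++ s))) (row1Desc K)
    ≡⟨ Σ⊆-cong-on (row1Desc K) (All.map proj₁ (All-row1Desc K)) pointwise ⟩
  Σ⊆ (λ s → χ (1 ≡ᵇ k) * χ (c + length s ≡ᵇ j)) (row1Desc K)  ≡⟨ Σ⊆-*ˡ (χ (1 ≡ᵇ k)) _ (row1Desc K) ⟩
  χ (1 ≡ᵇ k) * Σ⊆ (λ s → χ (c + length s ≡ᵇ j)) (row1Desc K)   ≡⟨ cong (χ (1 ≡ᵇ k) *_) (Σ⊆-length (row1Desc K) c j) ⟩
  χ (1 ≡ᵇ k) * (χ (c ≤ᵇ j) * (length (row1Desc K) C (j ∸ c)))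
    ≡⟨ cong (λ z → χ (1 ≡ᵇ k) * (χ (c ≤ᵇ j) * (z C (j ∸ c)))) (length-row1Desc K) ⟩
  χ (1 ≡ᵇ k) * (χ (c ≤ᵇ j) * (K C (j ∸ c)))                    ∎
  where
  open ≡-Reasoning
  c : ℕ
  c = suc (length u)
  pointwise : ∀ s → All (λ c → proj₁ c ≡ 1) s → χ (counted N j k ((x ∷ u) ++ s)) ≡ χ (1 ≡ᵇ k) * χ (c + length s ≡ᵇ j)
  pointwise s row1-s rewrite isIndependent-row1 ((x ∷ u) ++ s) (++⁺ row1 row1-s) | rowsOcc-row1 N x (u ++ s) 1≤N (++⁺ row1 row1-s)
    | length-++ u {s} = trans (χ-∧ (suc (length u + length s) ≡ᵇ j) (1 ≡ᵇ k)) (*-comm (χ (suc (length u + length s) ≡ᵇ j)) (χ (1 ≡ᵇ k)))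

-- Splitting off the last cell of the first row

hook : ℕ → List Cell
hook M = row1Desc M ++ columnCells (suc M) 2 M

dCount : ℕ → ℕ → ℕ → ℕ
dCount zero j k = 0
dCount (suc M) j k = Σ⊆ (λ s → χ (counted (suc M) j k ((1 , suc M) ∷ s))) (hook M)

All-InB-hook : ∀ M → All (InB (suc M)) (hook M)
All-InB-hook M = ++⁺ (All.map (λ { (refl , q , r) → ≤-refl , q , m≤n⇒m≤1+n r }) (All-row1Desc M))
  (All.map (λ { {(i , j)} (refl , p , q) → ≤-trans (s≤s z≤n) p , ≤-pred q , ≤-refl }) (All-columnCells (suc M) 2 M))

Σ⊆-maxRow1Cell : ∀ n a b M → M ≤ n →
  Σ⊆ (λ t → χ (counted (suc n) a b ((1 , suc M) ∷ t))) (row1Desc M ++ shiftedB 1 n) ≡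
  Σℕ a (λ j → Σℕ b (λ k → dCount (suc M) j k * countUD (suc n ∸ suc M) (a ∸ j) (b ∸ k)))
Σ⊆-maxRow1Cell n a b M M≤n = begin
  Σ⊆ (weight a b) (row1Desc M ++ shiftedB 1 n)
    ≡⟨ Σ⊆-counted-filter (suc n) a b [ (1 , m) ] (1 , m) (compatible (1 , m)) (row1Desc M ++ shiftedB 1 n) (here refl) (λ y e → e) ⟩
  Σ⊆ (weight a b) (filterᵇ (compatible (1 , m)) (row1Desc M ++ shiftedB 1 n))
    ≡⟨ cong (Σ⊆ (weight a b)) survivors ⟩
  Σ⊆ (weight a b) (hook M ++ shiftedB m (n ∸ M))
    ≡⟨ Σ⊆-counted-product (suc n) a b m {SA = InB m} {SC = InShiftedB m (n ∸ M)} separated (λ { (_ , i≤j , j≤m) → ≤-trans i≤j j≤m })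
         proj₁ (hook M) (shiftedB m (n ∸ M)) [ (1 , m) ] ((≤-refl , s≤s z≤n , ≤-refl) ∷ []) (All-InB-hook M) (All-shiftedB m (n ∸ M)) ⟩
  Σℕ a (λ j → Σℕ b (λ k → Σ⊆ (weight j k) (hook M) * Σ⊆ (λ t → χ (counted (suc n) (a ∸ j) (b ∸ k) t)) (shiftedB m (n ∸ M))))
    ≡⟨ Σℕ-cong a (λ j → Σℕ-cong b (λ k → cong₂ _*_ (hookCount j k) (restCount (a ∸ j) (b ∸ k)))) ⟩
  Σℕ a (λ j → Σℕ b (λ k → dCount m j k * countUD (suc n ∸ m) (a ∸ j) (b ∸ k))) ∎
  where
  open ≡-Reasoning
  m : ℕ
  m = suc M
  weight : ℕ → ℕ → List Cell → ℕ
  weight j k t = χ (counted (suc n) j k ((1 , m) ∷ t))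
  survivors : filterᵇ (compatible (1 , m)) (row1Desc M ++ shiftedB 1 n) ≡ hook M ++ shiftedB m (n ∸ M)
  survivors = trans (filter-++ _ (row1Desc M) (shiftedB 1 n))
    (trans (cong₂ _++_ (filterᵇ-all (All.map (λ { {(i , j)} (refl , _) → compatible-row1 m j }) (All-row1Desc M)))
                       (filterᵇ-shiftedB m n 1 ≤-refl (s≤s z≤n) (s≤s M≤n)))
      (sym (++-assoc (row1Desc M) (columnCells m 2 M) (shiftedB m (n ∸ M)))))
  separated : ∀ p q → InB m p → InShiftedB m (n ∸ M) q → (compatible p q ≡ true) × (compatible q p ≡ true)
  separated (i , j) (k , l) (_ , i≤j , j≤m) (m<k , k≤l , _) = compatible-separated i j k l i≤j (≤-<-trans j≤m m<k) k≤l
  hookCount : ∀ j k → Σ⊆ (weight j k) (hook M) ≡ dCount m j k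
  hookCount j k = Σ⊆-cong-on (hook M) (All-InB-hook M) (λ t at → cong χ
    (counted-cong (suc n) m j k ((1 , m) ∷ t) ((1 , m) ∷ t) refl refl
      (rowsOcc-stable m (suc n) (All.map (λ { (_ , i≤j , j≤m) → ≤-trans i≤j j≤m }) ((≤-refl , s≤s z≤n , ≤-refl) ∷ at)) (s≤s M≤n))))
  restCount : ∀ x y → Σ⊆ (λ t → χ (counted (suc n) x y t)) (shiftedB m (n ∸ M)) ≡ countUD (suc n ∸ m) x y
  restCount x y = trans (cong (λ z → Σ⊆ (λ t → χ (counted z x y t)) (shiftedB m (n ∸ M))) (sym (cong suc (m+[n∸m]≡n M≤n))))
    (Σ⊆-counted-shiftedB m (n ∸ M) x y)

dConv : ℕ → ℕ → ℕ → ℕ → ℕ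
dConv N a b i = Σℕ a (λ j → Σℕ b (λ k → dCount i j k * countUD (N ∸ i) (a ∸ j) (b ∸ k)))

dConv-0 : ∀ N a b → dConv N a b 0 ≡ 0
dConv-0 N a b = trans (Σℕ-cong a (λ j → Σℕ-0 b)) (Σℕ-0 a)

Σ⊆-row1Desc-shiftedB : ∀ n a b M → M ≤ suc n →
  Σ⊆ (λ I → χ (counted (suc n) a b I)) (row1Desc M ++ shiftedB 1 n) ≡ countUD n a b + Σℕ M (dConv (suc n) a b)
Σ⊆-row1Desc-shiftedB n a b zero _ =
  trans (Σ⊆-counted-shiftedB 1 n a b) (sym (trans (cong (_+_ (countUD n a b)) (dConv-0 (suc n) a b)) (+-identityʳ _)))
Σ⊆-row1Desc-shiftedB n a b (suc M) M<1+n =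
  trans (cong₂ _+_ (Σ⊆-row1Desc-shiftedB n a b M (m≤n⇒m≤1+n (≤-pred M<1+n))) (Σ⊆-maxRow1Cell n a b M (≤-pred M<1+n)))
    (+-assoc (countUD n a b) _ _)

countUD-suc : ∀ n a b → countUD (suc n) a b ≡ countUD n a b + Σℕ (suc n) (dConv (suc n) a b)
countUD-suc n a b = begin
  countUD (suc n) a b                                         ≡⟨ countUD≡Σ⊆ (suc n) a b ⟩
  Σ⊆ (λ I → χ (counted (suc n) a b I)) (shiftedB 0 (suc n))
    ≡⟨ Σ⊆-row1-reverse _ (counted-SwapInvariant (suc n) a b []) (suc n) (shiftedB 1 n) ⟩
  Σ⊆ (λ I → χ (counted (suc n) a b I)) (row1Desc (suc n) ++ shiftedB 1 n) ≡⟨ Σ⊆-row1Desc-shiftedB n a b (suc n) ≤-refl ⟩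
  countUD n a b + Σℕ (suc n) (dConv (suc n) a b)              ∎
  where open ≡-Reasoning

-- A recursion for dCount

-- Moving column M + 2 onto column M + 1 identifies the sets counted by dCount (M + 1) with the sets
-- made of (1 , M + 2) and cells of `hook (M + 1)` other than (1 , M + 1) and (M + 2 , M + 2).
module _ (M : ℕ) where
  private
    m : ℕ
    m = suc (suc M)

    ≤M⇒<m : ∀ {a} → a ≤ M → a < m
    ≤M⇒<m le = ≤-<-trans le (≤-trans (n<1+n M) (n≤1+n (suc M)))

  pullColumn : Cell → Cell
  pullColumn (i , j) = (i , (if j ≡ᵇ m then suc M else j))

  HookCell : Cell → Set
  HookCell c = (proj₁ c ≡ 1 × proj₂ c ≤ M) ⊎ (proj₂ c ≡ m × 1 ≤ proj₁ c × proj₁ c ≤ suc M)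

  pullColumn-fixes : ∀ i j → j ≤ M → pullColumn (i , j) ≡ (i , j)
  pullColumn-fixes i j le rewrite ≡ᵇ-false {j} {m} (<⇒≢ (≤M⇒<m le)) = refl

  pullColumn-moves : ∀ i → pullColumn (i , m) ≡ (i , suc M)
  pullColumn-moves i rewrite ≡ᵇ-true {m} refl = refl

  compatible-pullColumn : ∀ p q → HookCell p → HookCell q → compatible (pullColumn p) (pullColumn q) ≡ compatible p q
  compatible-pullColumn (.1 , a) (.1 , b) (inj₁ (refl , la)) (inj₁ (refl , lb)) =
    cong₂ compatible (pullColumn-fixes 1 a la) (pullColumn-fixes 1 b lb)
  compatible-pullColumn (r , .m) (r' , .m) (inj₂ (refl , _)) (inj₂ (refl , _)) =
    trans (cong₂ compatible (pullColumn-moves r) (pullColumn-moves r')) (trans (compatible-sameColumn r r' (suc M)) (sym (compatible-sameColumn r r' m)))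
  compatible-pullColumn (.1 , a) (r , .m) (inj₁ (refl , la)) (inj₂ (refl , _)) =
    trans (cong₂ compatible (pullColumn-fixes 1 a la) (pullColumn-moves r)) (compatible-row1-column a r (suc M) m (s≤s la) (≤M⇒<m la))
  compatible-pullColumn (r , .m) (.1 , a) (inj₂ (refl , _)) (inj₁ (refl , la)) =
    trans (cong₂ compatible (pullColumn-moves r) (pullColumn-fixes 1 a la)) (compatible-column-row1 a r (suc M) m (s≤s la) (≤M⇒<m la))

  rowsOcc-pullColumn : ∀ N w → rowsOcc N (map pullColumn w) ≡ rowsOcc N w
  rowsOcc-pullColumn N w = trans (rowsOcc≡countᵇ N (map pullColumn w)) (trans (countᵇ-cong (upFrom 1 N)
      (λ r → trans (any-map _ pullColumn w) (any-cong w (λ { (i , j) → refl })))) (sym (rowsOcc≡countᵇ N w)))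

  counted-pullColumn : ∀ N a b {w} → All HookCell w → counted N a b (map pullColumn w) ≡ counted N a b w
  counted-pullColumn N a b {w} aw =
    counted-cong N N a b (map pullColumn w) w (isIndependent-map pullColumn compatible-pullColumn aw) (length-map pullColumn w) (rowsOcc-pullColumn N w)

  map-pullColumn-hook : map pullColumn (row1Desc M ++ columnCells m 2 M) ≡ row1Desc M ++ columnCells (suc M) 2 M
  map-pullColumn-hook = trans (map-++ pullColumn (row1Desc M) (columnCells m 2 M))
    (cong₂ _++_ (map-id-local (All.map (λ { {(i , j)} (_ , _ , le) → pullColumn-fixes i j le }) (All-row1Desc M)))
      (trans (sym (map-∘ (upFrom 2 M))) (map-cong (λ i → pullColumn-moves i) (upFrom 2 M))))

  All-HookCell : All HookCell ((1 , m) ∷ row1Desc M ++ columnCells m 2 M)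
  All-HookCell = inj₂ (refl , ≤-refl , s≤s z≤n) ∷ ++⁺ (All.map (λ { (p , _ , r) → inj₁ (p , r) }) (All-row1Desc M))
    (All.map (λ { (p , q , r) → inj₂ (p , ≤-trans (s≤s z≤n) q , ≤-pred r) }) (All-columnCells m 2 M))

  HookCell-row≤ : ∀ {c} → HookCell c → proj₁ c ≤ suc M
  HookCell-row≤ (inj₁ (refl , _)) = s≤s z≤n
  HookCell-row≤ (inj₂ (_ , _ , r)) = r

  HookCell-corner : HookCell (1 , m)
  HookCell-corner = inj₂ (refl , ≤-refl , s≤s z≤n)

  dCount-relabel : ∀ j k → Σ⊆ (λ s → χ (counted m j k ((1 , m) ∷ s))) (row1Desc M ++ columnCells m 2 M) ≡ dCount (suc M) j k
  dCount-relabel j k = begin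
    Σ⊆ (weight m) cells                            ≡⟨ Σ⊆-cong-on cells (All.tail All-HookCell) (λ t at → cong χ (relabel t at)) ⟩
    Σ⊆ (weight (suc M) ∘ map pullColumn) cells     ≡⟨ sym (Σ⊆-map pullColumn (weight (suc M)) cells) ⟩
    Σ⊆ (weight (suc M)) (map pullColumn cells)     ≡⟨ cong (Σ⊆ (weight (suc M))) map-pullColumn-hook ⟩
    dCount (suc M) j k                             ∎
    where
    open ≡-Reasoning
    cells : List Cell
    cells = row1Desc M ++ columnCells m 2 M
    weight : ℕ → List Cell → ℕ
    weight N t = χ (counted N j k ((1 , N) ∷ t))
    relabel : ∀ t → All HookCell t → counted m j k ((1 , m) ∷ t) ≡ counted (suc M) j k ((1 , suc M) ∷ map pullColumn t)
    relabel t at = sym (begin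
      counted (suc M) j k ((1 , suc M) ∷ map pullColumn t)
        ≡⟨ cong (λ z → counted (suc M) j k (z ∷ map pullColumn t)) (sym (pullColumn-moves 1)) ⟩
      counted (suc M) j k (map pullColumn ((1 , m) ∷ t))
        ≡⟨ counted-pullColumn (suc M) j k (HookCell-corner ∷ at) ⟩
      counted (suc M) j k ((1 , m) ∷ t)
        ≡⟨ counted-cong (suc M) m j k ((1 , m) ∷ t) ((1 , m) ∷ t) refl refl
             (sym (rowsOcc-stable (suc M) m (All.map HookCell-row≤ (HookCell-corner ∷ at)) (n≤1+n (suc M)))) ⟩
      counted m j k ((1 , m) ∷ t)                            ∎)

-- The subsets of row 1 of size a that contain (1 , M + 2) and (1 , M + 1) and otherwise lie left of
-- them: all of them are independent and occupy one row.
rCount : ℕ → ℕ → ℕ → ℕ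
rCount M a b = χ (1 ≡ᵇ b) * (χ (2 ≤ᵇ a) * (M C (a ∸ 2)))

positive : ℕ → ℕ → ℕ
positive a b = χ ((1 ≤ᵇ a) ∧ (1 ≤ᵇ b))

module _ (M : ℕ) where
  private
    m : ℕ
    m = suc (suc M)

  BelowColumn : Cell → Set
  BelowColumn c = proj₁ c ≤ suc M × proj₁ c ≤ proj₂ c × proj₂ c ≤ m

  IsCorner : Cell → Set
  IsCorner c = c ≡ (m , m)

  compatible-corner : ∀ p q → BelowColumn p → IsCorner q → (compatible p q ≡ true) × (compatible q p ≡ true)
  compatible-corner (i , j) .(m , m) (_ , b , c) refl = compatible-diagonal i j m b c

  BelowColumn-row≤ : ∀ {c} → BelowColumn c → proj₁ c ≤ suc M
  BelowColumn-row≤ = proj₁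

  IsCorner-row> : ∀ {c} → IsCorner c → suc M < proj₁ c
  IsCorner-row> refl = ≤-refl

  All-BelowColumn-row1Desc : All BelowColumn (row1Desc M)
  All-BelowColumn-row1Desc = All.map (λ { (refl , q , r) → s≤s z≤n , q , ≤-trans r (≤-trans (n≤1+n M) (n≤1+n (suc M))) }) (All-row1Desc M)

  All-BelowColumn-columnCells : All BelowColumn (columnCells m 2 M)
  All-BelowColumn-columnCells = All.map (λ { (refl , p , q) → ≤-pred q , ≤-trans (≤-pred q) (n≤1+n (suc M)) , ≤-refl }) (All-columnCells m 2 M)

  All-IsCorner : All IsCorner [ (m , m) ]
  All-IsCorner = refl ∷ []

  Σ⊆-corner : ∀ x y → Σ⊆ (λ t → χ (counted m x y t)) [ (m , m) ] ≡ cellWeight x y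
  Σ⊆-corner x y = Σ⊆-[-] m (m , m) x y (s≤s z≤n) ≤-refl

  dCount-avoiding : ∀ j k → Σ⊆ (λ s → χ (counted m j k ((1 , m) ∷ s))) (row1Desc M ++ columnCells m 2 (suc M)) ≡
     dCount (suc M) j k + positive j k * dCount (suc M) (j ∸ 1) (k ∸ 1)
  dCount-avoiding j k =
    trans (cong (Σ⊆ _) (trans (cong (row1Desc M ++_) (columnCells-∷ʳ m 2 M)) (sym (++-assoc (row1Desc M) (columnCells m 2 M) [ (m , m) ]))))
    (trans (Σ⊆-counted-product m j k (suc M) {BelowColumn} {IsCorner} compatible-corner BelowColumn-row≤ IsCorner-row>
              (row1Desc M ++ columnCells m 2 M) [ (m , m) ] [ (1 , m) ]
              ((s≤s z≤n , s≤s z≤n , ≤-refl) ∷ []) (++⁺ All-BelowColumn-row1Desc All-BelowColumn-columnCells) All-IsCorner)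
    (trans (Σℕ-cong j (λ j' → Σℕ-cong k (λ k' → cong₂ _*_ (dCount-relabel M j' k') (Σ⊆-corner (j ∸ j') (k ∸ k')))))
     (Σℕ-cellWeight (dCount (suc M)) j k)))

  filterᵇ-hook : filterᵇ (compatible (1 , suc M)) (row1Desc M ++ columnCells m 2 (suc M)) ≡ row1Desc M ++ [ (m , m) ]
  filterᵇ-hook = trans (filter-++ _ (row1Desc M) (columnCells m 2 (suc M)))
    (cong₂ _++_ (filterᵇ-all (All.map (λ { {(i , j)} (refl , _) → compatible-row1 (suc M) j }) (All-row1Desc M)))
      (filterᵇ-single (compatible (1 , suc M)) (λ i → (i , m)) 2 (suc M) m (s≤s (s≤s z≤n)) ≤-refl
         (λ t le lt → compatible-1m-nextColumn M t le (≤-pred lt))))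

  dCount-containing : ∀ j k → Σ⊆ (λ s → χ (counted m j k ((1 , m) ∷ (1 , suc M) ∷ s))) (row1Desc M ++ columnCells m 2 (suc M)) ≡
     rCount M j k + positive j k * rCount M (j ∸ 1) (k ∸ 1)
  dCount-containing j k =
    trans (Σ⊆-counted-filter m j k ((1 , m) ∷ (1 , suc M) ∷ []) (1 , suc M) (compatible (1 , suc M)) (row1Desc M ++ columnCells m 2 (suc M))
             (there (here refl)) (λ y e → e))
    (trans (cong (Σ⊆ _) filterᵇ-hook)
    (trans (Σ⊆-counted-product m j k (suc M) {BelowColumn} {IsCorner} compatible-corner BelowColumn-row≤ IsCorner-row>
              (row1Desc M) [ (m , m) ] ((1 , m) ∷ (1 , suc M) ∷ [])
              ((s≤s z≤n , s≤s z≤n , ≤-refl) ∷ (s≤s z≤n , s≤s z≤n , n≤1+n (suc M)) ∷ []) All-BelowColumn-row1Desc All-IsCorner)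
    (trans (Σℕ-cong j (λ j' → Σℕ-cong k (λ k' → cong₂ _*_
               (Σ⊆-row1Desc m j' k' (1 , m) [ (1 , suc M) ] M (s≤s z≤n) (refl ∷ refl ∷ []))
               (Σ⊆-corner (j ∸ j') (k ∸ k')))))
     (Σℕ-cellWeight (rCount M) j k))))

-- Split by whether (1 , M + 1) is chosen.  The corner (M + 2 , M + 2) is compatible with every other
-- cell of the hook, so it contributes the factor 1 + y z in both cases.
dCount-suc-suc : ∀ M j k → dCount (suc (suc M)) j k ≡
  (dCount (suc M) j k + positive j k * dCount (suc M) (j ∸ 1) (k ∸ 1)) + (rCount M j k + positive j k * rCount M (j ∸ 1) (k ∸ 1))
dCount-suc-suc M j k = cong₂ _+_ (dCount-avoiding M j k) (dCount-containing M j k)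

kCount : ℕ → ℕ → ℕ → ℕ
kCount zero a b = 0
kCount (suc zero) a b = χ ((1 ≡ᵇ a) ∧ (1 ≡ᵇ b))
kCount (suc (suc M)) a b = rCount M a b + positive a b * rCount M (a ∸ 1) (b ∸ 1)

dCount-suc : ∀ n a b → dCount (suc n) a b ≡ (dCount n a b + positive a b * dCount n (a ∸ 1) (b ∸ 1)) + kCount (suc n) a b
dCount-suc zero a b = sym (cong (_+ kCount 1 a b) (*-zeroʳ (positive a b)))
dCount-suc (suc M) a b = dCount-suc-suc M a b

rCount-pascal : ∀ M a b → rCount (suc M) a b ≡ rCount M a b + χ (1 ≤ᵇ a) * rCount M (a ∸ 1) b
rCount-pascal M zero b = nsolve 1 (λ c → c ⊠ ncon 0 ≐ c ⊠ ncon 0 ⊹ ncon 0) refl (χ (1 ≡ᵇ b))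
rCount-pascal M (suc zero) b = nsolve 1 (λ c → c ⊠ ncon 0 ≐ c ⊠ ncon 0 ⊹ ncon 1 ⊠ (c ⊠ ncon 0)) refl (χ (1 ≡ᵇ b))
rCount-pascal M (suc (suc zero)) b = nsolve 1 (λ c → c ⊠ (ncon 1 ⊠ ncon 1) ≐ c ⊠ (ncon 1 ⊠ ncon 1) ⊹ ncon 1 ⊠ (c ⊠ ncon 0)) refl (χ (1 ≡ᵇ b))
rCount-pascal M (suc (suc (suc a))) b =
  trans (cong (λ t → χ (1 ≡ᵇ b) * (1 * t)) (sym (nCk+nC[k+1]≡[n+1]C[k+1] M a)))
    (nsolve 3 (λ c u v → c ⊠ (ncon 1 ⊠ (u ⊹ v)) ≐ c ⊠ (ncon 1 ⊠ v) ⊹ ncon 1 ⊠ (c ⊠ (ncon 1 ⊠ u))) refl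
      (χ (1 ≡ᵇ b)) (M C a) (M C suc a))

kCount-pascal : ∀ M a b → kCount (suc (suc (suc M))) a b ≡ kCount (suc (suc M)) a b + χ (1 ≤ᵇ a) * kCount (suc (suc M)) (a ∸ 1) b
kCount-pascal M zero b = nsolve 1 (λ c → c ⊠ ncon 0 ⊹ ncon 0 ≐ (c ⊠ ncon 0 ⊹ ncon 0) ⊹ ncon 0) refl (χ (1 ≡ᵇ b))
kCount-pascal M (suc a) zero rewrite rCount-pascal M (suc a) zero | ∧-zeroʳ (1 ≤ᵇ a) =
  nsolve 2 (λ x y → (x ⊹ ncon 1 ⊠ y) ⊹ ncon 0 ≐ (x ⊹ ncon 0) ⊹ ncon 1 ⊠ (y ⊹ ncon 0)) refl
    (rCount M (suc a) zero) (rCount M a zero)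
kCount-pascal M (suc a) (suc b) rewrite rCount-pascal M (suc a) (suc b) | rCount-pascal M a b | ∧-identityʳ (1 ≤ᵇ a) =
  nsolve 5 (λ x y g z w → (x ⊹ ncon 1 ⊠ y) ⊹ ncon 1 ⊠ (z ⊹ g ⊠ w) ≐ (x ⊹ ncon 1 ⊠ z) ⊹ ncon 1 ⊠ (y ⊹ g ⊠ w)) refl
    (rCount M (suc a) (suc b)) (rCount M a (suc b)) (χ (1 ≤ᵇ a)) (rCount M a b) (rCount M (a ∸ 1) b)

-- Formal power series

Σ≤-cong : ∀ n {f g : ℕ → ℤ} → (∀ i → f i ≡ g i) → Σ≤ n f ≡ Σ≤ n g
Σ≤-cong zero e = e zero
Σ≤-cong (suc n) e = cong₂ Z._+_ (Σ≤-cong n e) (e (suc n))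

Σ≤-cong-≤ : ∀ n {f g : ℕ → ℤ} → (∀ i → i ≤ n → f i ≡ g i) → Σ≤ n f ≡ Σ≤ n g
Σ≤-cong-≤ zero e = e zero z≤n
Σ≤-cong-≤ (suc n) e = cong₂ Z._+_ (Σ≤-cong-≤ n (λ i le → e i (m≤n⇒m≤1+n le))) (e (suc n) ≤-refl)

Σ≤-+ : ∀ n (f g : ℕ → ℤ) → Σ≤ n (λ i → f i Z.+ g i) ≡ Σ≤ n f Z.+ Σ≤ n g
Σ≤-+ zero f g = refl
Σ≤-+ (suc n) f g rewrite Σ≤-+ n f g = solve 4 (λ a b c d → (a :+ b) :+ (c :+ d) := (a :+ c) :+ (b :+ d)) refl (Σ≤ n f) (Σ≤ n g) (f (suc n)) (g (suc n))

Σ≤-- : ∀ n (f g : ℕ → ℤ) → Σ≤ n (λ i → f i Z.- g i) ≡ Σ≤ n f Z.- Σ≤ n g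
Σ≤-- zero f g = refl
Σ≤-- (suc n) f g rewrite Σ≤-- n f g = solve 4 (λ a b c d → (a :- b) :+ (c :- d) := (a :+ c) :- (b :+ d)) refl (Σ≤ n f) (Σ≤ n g) (f (suc n)) (g (suc n))

Σ≤-0 : ∀ n → Σ≤ n (λ _ → + 0) ≡ + 0
Σ≤-0 zero = refl
Σ≤-0 (suc n) rewrite Σ≤-0 n = refl

Σ≤-if : ∀ n c (f : ℕ → ℤ) → Σ≤ n (λ i → if c then f i else + 0) ≡ (if c then Σ≤ n f else + 0)
Σ≤-if n true f = refl
Σ≤-if n false f = Σ≤-0 n

Σ≤-δ : ∀ n p (f : ℕ → ℤ) → Σ≤ n (λ i → if (i ≡ᵇ p) then f i else + 0) ≡ (if p ≤ᵇ n then f p else + 0)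
Σ≤-δ zero zero f = refl
Σ≤-δ zero (suc p) f = refl
Σ≤-δ (suc n) p f with <-cmp p (suc n)
... | tri< lt _ _ rewrite Σ≤-δ n p f | ≤ᵇ-true (≤-pred lt) | ≡ᵇ-false {suc n} {p} (>⇒≢ lt) | ≤ᵇ-true (<⇒≤ lt) = ZP.+-identityʳ _
... | tri≈ _ refl _ rewrite Σ≤-δ n (suc n) f | ≤ᵇ-false {suc n} {n} (<⇒≱ ≤-refl) | ≡ᵇ-true {suc n} refl
                          | ≤ᵇ-true {suc n} {suc n} ≤-refl = ZP.+-identityˡ _
... | tri> _ _ gt rewrite Σ≤-δ n p f | ≤ᵇ-false {p} {n} (<⇒≱ (<-trans (n<1+n n) gt)) | ≡ᵇ-false {suc n} {p} (<⇒≢ gt)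
                        | ≤ᵇ-false {p} {suc n} (<⇒≱ gt) = refl

Σ≤-pos : ∀ n (f : ℕ → ℕ) → Σ≤ n (λ i → + f i) ≡ + Σℕ n f
Σ≤-pos zero f = refl
Σ≤-pos (suc n) f rewrite Σ≤-pos n f = sym (ZP.pos-+ (Σℕ n f) (f (suc n)))

Σ≤-suc : ∀ n (f : ℕ → ℤ) → Σ≤ (suc n) f ≡ f 0 Z.+ Σ≤ n (λ i → f (suc i))
Σ≤-suc zero f = refl
Σ≤-suc (suc n) f rewrite Σ≤-suc n f = ZP.+-assoc (f 0) _ _

Σ≤-reverse : ∀ n (h : ℕ → ℤ) → Σ≤ n h ≡ Σ≤ n (λ i → h (n ∸ i))
Σ≤-reverse zero h = refl
Σ≤-reverse (suc n) h =
  (trans (ZP.+-comm (Σ≤ n h) (h (suc n)))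
  (trans (cong (λ z → h (suc n) Z.+ z) (Σ≤-reverse n h))
   (sym (Σ≤-suc n (λ i → h (suc n ∸ i))))))

⊛-comm : ∀ E F → E ⊛ F ≈ F ⊛ E
⊛-comm E F n a b =
  trans (Σ≤-reverse n _) (Σ≤-cong-≤ n (λ i li →
  trans (Σ≤-reverse a _) (Σ≤-cong-≤ a (λ j lj →
  trans (Σ≤-reverse b _) (Σ≤-cong-≤ b (λ k lk →
  trans (cong₂ (λ u v → E (n ∸ i) (a ∸ j) (b ∸ k) Z.* F u v _) (m∸[m∸n]≡n li) (m∸[m∸n]≡n lj))
   (trans (cong (λ w → E (n ∸ i) (a ∸ j) (b ∸ k) Z.* F i j w) (m∸[m∸n]≡n lk))
    (ZP.*-comm (E (n ∸ i) (a ∸ j) (b ∸ k)) (F i j k)))))))))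

⊕-cong : ∀ {A B C D} → A ≈ B → C ≈ D → A ⊕ C ≈ B ⊕ D
⊕-cong e f n a b = cong₂ Z._+_ (e n a b) (f n a b)

⊖-cong : ∀ {A B C D} → A ≈ B → C ≈ D → A ⊖ C ≈ B ⊖ D
⊖-cong e f n a b = cong₂ Z._-_ (e n a b) (f n a b)

≈-trans : ∀ {A B C} → A ≈ B → B ≈ C → A ≈ C
≈-trans e f n a b = trans (e n a b) (f n a b)

≈-sym : ∀ {A B} → A ≈ B → B ≈ A
≈-sym e n a b = sym (e n a b)

≈-refl : ∀ {A} → A ≈ A
≈-refl _ _ _ = refl

≈-setoid : Setoid 0ℓ 0ℓ
≈-setoid = record { Carrier = PS ; _≈_ = _≈_ ; isEquivalence = record { refl = ≈-refl ; sym = ≈-sym ; trans = ≈-trans } }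

module ≈-Reasoning = Relation.Binary.Reasoning.Setoid ≈-setoid

𝟘 : PS
𝟘 _ _ _ = + 0

⊛-⊕ʳ : ∀ E F G → E ⊛ (F ⊕ G) ≈ (E ⊛ F) ⊕ (E ⊛ G)
⊛-⊕ʳ E F G n a b =
  trans (Σ≤-cong n (λ i → trans (Σ≤-cong a (λ j → trans (Σ≤-cong b (λ k →
      ZP.*-distribˡ-+ (E i j k) (F (n ∸ i) (a ∸ j) (b ∸ k)) (G (n ∸ i) (a ∸ j) (b ∸ k))))
    (Σ≤-+ b _ _))) (Σ≤-+ a _ _)))
   (Σ≤-+ n _ _)

⊛-⊖ʳ : ∀ E F G → E ⊛ (F ⊖ G) ≈ (E ⊛ F) ⊖ (E ⊛ G)
⊛-⊖ʳ E F G n a b =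
  trans (Σ≤-cong n (λ i → trans (Σ≤-cong a (λ j → trans (Σ≤-cong b (λ k →
      solve 3 (λ x y z → x :* (y :- z) := x :* y :- x :* z) refl (E i j k) (F (n ∸ i) (a ∸ j) (b ∸ k)) (G (n ∸ i) (a ∸ j) (b ∸ k))))
    (Σ≤-- b _ _))) (Σ≤-- a _ _))) (Σ≤-- n _ _)

⊛-⊕ˡ : ∀ E F G → (F ⊕ G) ⊛ E ≈ (F ⊛ E) ⊕ (G ⊛ E)
⊛-⊕ˡ E F G n a b =
  trans (Σ≤-cong n (λ i → trans (Σ≤-cong a (λ j → trans (Σ≤-cong b (λ k →
      ZP.*-distribʳ-+ (E (n ∸ i) (a ∸ j) (b ∸ k)) (F i j k) (G i j k)))
    (Σ≤-+ b _ _))) (Σ≤-+ a _ _)))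
   (Σ≤-+ n _ _)

⊛-⊖ˡ : ∀ E F G → (F ⊖ G) ⊛ E ≈ (F ⊛ E) ⊖ (G ⊛ E)
⊛-⊖ˡ E F G n a b =
  trans (Σ≤-cong n (λ i → trans (Σ≤-cong a (λ j → trans (Σ≤-cong b (λ k →
      solve 3 (λ x y z → (y :- z) :* x := y :* x :- z :* x) refl (E (n ∸ i) (a ∸ j) (b ∸ k)) (F i j k) (G i j k)))
    (Σ≤-- b _ _))) (Σ≤-- a _ _))) (Σ≤-- n _ _)

⊛-congʳ : ∀ E {F G} → F ≈ G → E ⊛ F ≈ E ⊛ G
⊛-congʳ E e n a b = Σ≤-cong n (λ i → Σ≤-cong a (λ j → Σ≤-cong b (λ k → cong (E i j k Z.*_) (e _ _ _))))

⊛-congˡ : ∀ E {F G} → F ≈ G → F ⊛ E ≈ G ⊛ E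
⊛-congˡ E e n a b = Σ≤-cong n (λ i → Σ≤-cong a (λ j → Σ≤-cong b (λ k → cong (Z._* E (n ∸ i) (a ∸ j) (b ∸ k)) (e _ _ _))))

shift : ℕ → ℕ → ℕ → PS → PS
shift p q r E n a b = if p ≤ᵇ n then (if q ≤ᵇ a then (if r ≤ᵇ b then E (n ∸ p) (a ∸ q) (b ∸ r) else + 0) else + 0) else + 0

if-*ˡ : ∀ c (x : ℤ) → (if c then + 1 else + 0) Z.* x ≡ (if c then x else + 0)
if-*ˡ true x = ZP.*-identityˡ x
if-*ˡ false x = refl

if-∧ : ∀ c₁ c₂ (x : ℤ) → (if c₁ ∧ c₂ then x else + 0) ≡ (if c₁ then (if c₂ then x else + 0) else + 0)
if-∧ true c₂ x = refl
if-∧ false c₂ x = refl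

Σ≤-δ³ : ∀ n a b p q r (Y : ℕ → ℕ → ℕ → ℤ) →
  Σ≤ n (λ i → Σ≤ a (λ j → Σ≤ b (λ k → if (i ≡ᵇ p) then (if (j ≡ᵇ q) then (if (k ≡ᵇ r) then Y i j k else + 0) else + 0) else + 0)))
  ≡ (if p ≤ᵇ n then (if q ≤ᵇ a then (if r ≤ᵇ b then Y p q r else + 0) else + 0) else + 0)
Σ≤-δ³ n a b p q r Y =
  trans (Σ≤-cong n (λ i → trans (Σ≤-cong a (λ j →
          trans (Σ≤-if b (i ≡ᵇ p) _) (cong (λ z → if (i ≡ᵇ p) then z else + 0)
            (trans (Σ≤-if b (j ≡ᵇ q) _) (cong (λ z → if (j ≡ᵇ q) then z else + 0) (Σ≤-δ b r (Y i j)))))))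
        (trans (Σ≤-if a (i ≡ᵇ p) _) (cong (λ z → if (i ≡ᵇ p) then z else + 0)
            (Σ≤-δ a q (λ j → if r ≤ᵇ b then Y i j r else + 0))))))
  (Σ≤-δ n p (λ i → if q ≤ᵇ a then (if r ≤ᵇ b then Y i q r else + 0) else + 0))

mono-⊛ : ∀ p q r E → mono p q r ⊛ E ≈ shift p q r E
mono-⊛ p q r E n a b =
  trans (Σ≤-cong n (λ i → Σ≤-cong a (λ j → Σ≤-cong b (λ k →
     trans (if-*ˡ ((i ≡ᵇ p) ∧ (j ≡ᵇ q) ∧ (k ≡ᵇ r)) (E (n ∸ i) (a ∸ j) (b ∸ k)))
       (trans (if-∧ (i ≡ᵇ p) ((j ≡ᵇ q) ∧ (k ≡ᵇ r)) (E (n ∸ i) (a ∸ j) (b ∸ k)))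
         (cong (λ z → if (i ≡ᵇ p) then z else + 0) (if-∧ (j ≡ᵇ q) (k ≡ᵇ r) (E (n ∸ i) (a ∸ j) (b ∸ k)))))))))
  (Σ≤-δ³ n a b p q r (λ i j k → E (n ∸ i) (a ∸ j) (b ∸ k)))

⊛-mono : ∀ p q r E → E ⊛ mono p q r ≈ shift p q r E
⊛-mono p q r E n a b = trans (⊛-comm E (mono p q r) n a b) (mono-⊛ p q r E n a b)

shift-⊕ : ∀ p q r F G → shift p q r (F ⊕ G) ≈ shift p q r F ⊕ shift p q r G
shift-⊕ p q r F G n a b with p ≤ᵇ n | q ≤ᵇ a | r ≤ᵇ b
... | true | true | true = refl
... | true | true | false = refl
... | true | false | _ = refl
... | false | _ | _ = refl

shift-⊖ : ∀ p q r F G → shift p q r (F ⊖ G) ≈ shift p q r F ⊖ shift p q r G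
shift-⊖ p q r F G n a b with p ≤ᵇ n | q ≤ᵇ a | r ≤ᵇ b
... | true | true | true = refl
... | true | true | false = refl
... | true | false | _ = refl
... | false | _ | _ = refl

shift-cong : ∀ p q r {E F} → E ≈ F → shift p q r E ≈ shift p q r F
shift-cong p q r e n a b with p ≤ᵇ n | q ≤ᵇ a | r ≤ᵇ b
... | true | true | true = e _ _ _
... | true | true | false = refl
... | true | false | _ = refl
... | false | _ | _ = refl

≤ᵇ∧∸≡ᵇ : ∀ p p' n → ((p ≤ᵇ n) ∧ (n ∸ p ≡ᵇ p')) ≡ (n ≡ᵇ p + p')
≤ᵇ∧∸≡ᵇ p p' n with p ≤? n
... | yes le rewrite ≤ᵇ-true le with n ∸ p ≟ p'
...   | yes e rewrite ≡ᵇ-true e = sym (≡ᵇ-true (trans (sym (m+[n∸m]≡n le)) (cong (_+_ p) e)))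
...   | no ne rewrite ≡ᵇ-false ne = sym (≡ᵇ-false (λ e → ne (trans (cong (_∸ p) e) (m+n∸m≡n p p'))))
≤ᵇ∧∸≡ᵇ p p' n | no nle rewrite ≤ᵇ-false nle = sym (≡ᵇ-false (λ e → nle (subst (p ≤_) (sym e) (m≤m+n p p'))))

shift-mono : ∀ p q r p' q' r' → shift p q r (mono p' q' r') ≈ mono (p + p') (q + q') (r + r')
shift-mono p q r p' q' r' n a b rewrite sym (≤ᵇ∧∸≡ᵇ p p' n) | sym (≤ᵇ∧∸≡ᵇ q q' a) | sym (≤ᵇ∧∸≡ᵇ r r' b)
  with p ≤ᵇ n | q ≤ᵇ a | r ≤ᵇ b
... | true | true | true = refl
... | true | true | false = sym (z (n ∸ p ≡ᵇ p') (a ∸ q ≡ᵇ q'))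
  where z : ∀ x y → (if x ∧ y ∧ false then + 1 else + 0) ≡ + 0
        z true true = refl
        z true false = refl
        z false _ = refl
... | true | false | _ = sym (z (n ∸ p ≡ᵇ p') (b ≡ᵇ r + r'))
  where z : ∀ x y → (if x ∧ false ∧ y then + 1 else + 0) ≡ + 0
        z true _ = refl
        z false _ = refl
... | false | _ | _ = refl

≤ᵇ-∸ : ∀ p p' n → p ≤ n → (p' ≤ᵇ n ∸ p) ≡ (p + p' ≤ᵇ n)
≤ᵇ-∸ p p' n le with p' ≤? n ∸ p
... | yes l rewrite ≤ᵇ-true l = sym (≤ᵇ-true (subst (p + p' ≤_) (m+[n∸m]≡n le) (+-monoʳ-≤ p l)))
... | no nl rewrite ≤ᵇ-false nl = sym (≤ᵇ-false (λ h → nl (≤-trans (≤-reflexive (sym (m+n∸m≡n p p'))) (∸-monoˡ-≤ p h))))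

≤ᵇ-+-false : ∀ p p' n → ¬ p ≤ n → (p + p' ≤ᵇ n) ≡ false
≤ᵇ-+-false p p' n nl = ≤ᵇ-false (λ h → nl (≤-trans (m≤m+n p p') h))

if-0 : ∀ c → (if c then + 0 else + 0) ≡ + 0
if-0 true = refl
if-0 false = refl

shift-shift : ∀ p q r p' q' r' E → shift p q r (shift p' q' r' E) ≈ shift (p + p') (q + q') (r + r') E
shift-shift p q r p' q' r' E n a b with p ≤? n
shift-shift p q r p' q' r' E n a b | no nl rewrite ≤ᵇ-false nl | ≤ᵇ-+-false p p' n nl = refl
shift-shift p q r p' q' r' E n a b | yes lp rewrite ≤ᵇ-true lp | ≤ᵇ-∸ p p' n lp with q ≤? a
... | no nq rewrite ≤ᵇ-false nq | ≤ᵇ-+-false q q' a nq = sym (if-0 (p + p' ≤ᵇ n))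
... | yes lq rewrite ≤ᵇ-true lq | ≤ᵇ-∸ q q' a lq with r ≤? b
...   | no nr rewrite ≤ᵇ-false nr | ≤ᵇ-+-false r r' b nr = sym (trans (cong (λ z → if p + p' ≤ᵇ n then z else + 0) (if-0 (q + q' ≤ᵇ a))) (if-0 _))
...   | yes lr rewrite ≤ᵇ-true lr | ≤ᵇ-∸ r r' b lr | ∸-+-assoc n p p' | ∸-+-assoc a q q' | ∸-+-assoc b r r' = refl

den₂ : PS
den₂ = mono 1 1 0 ⊕ X ⊖ 𝟙

shift-den₂ : ∀ p q r → shift p q r den₂ ≈ (mono (p + 1) (q + 1) (r + 0) ⊕ mono (p + 1) (q + 0) (r + 0)) ⊖ mono (p + 0) (q + 0) (r + 0)
shift-den₂ p q r = ≈-trans (shift-⊖ p q r (mono 1 1 0 ⊕ X) 𝟙)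
  (⊖-cong (≈-trans (shift-⊕ p q r (mono 1 1 0) X) (⊕-cong (shift-mono p q r 1 1 0) (shift-mono p q r 1 0 0))) (shift-mono p q r 0 0 0))

xyzDen₂ xDen₂ den₂Terms : PS
xyzDen₂ = (mono 2 2 1 ⊕ mono 2 1 1) ⊖ mono 1 1 1
xDen₂ = (mono 2 1 0 ⊕ mono 2 0 0) ⊖ mono 1 0 0
den₂Terms = (mono 1 1 0 ⊕ mono 1 0 0) ⊖ mono 0 0 0

D-den-expanded : PS
D-den-expanded = xyzDen₂ ⊕ xDen₂ ⊖ den₂Terms

D-den≈expanded : D-den ≈ D-den-expanded
D-den≈expanded = ≈-trans (⊛-⊖ˡ den₂ (mono 1 1 1 ⊕ X) 𝟙)
  (⊖-cong (≈-trans (⊛-⊕ˡ den₂ (mono 1 1 1) X)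
             (⊕-cong (≈-trans (mono-⊛ 1 1 1 den₂) (shift-den₂ 1 1 1)) (≈-trans (mono-⊛ 1 0 0 den₂) (shift-den₂ 1 0 0))))
          (≈-trans (mono-⊛ 0 0 0 den₂) (shift-den₂ 0 0 0)))

⊛D-den-expanded : PS → PS
⊛D-den-expanded E =
  ((shift 2 2 1 E ⊕ shift 2 1 1 E) ⊖ shift 1 1 1 E ⊕ ((shift 2 1 0 E ⊕ shift 2 0 0 E) ⊖ shift 1 0 0 E))
  ⊖ ((shift 1 1 0 E ⊕ shift 1 0 0 E) ⊖ shift 0 0 0 E)

⊛-trinomial : ∀ E p q r p' q' r' p'' q'' r'' →
  E ⊛ ((mono p q r ⊕ mono p' q' r') ⊖ mono p'' q'' r'') ≈ (shift p q r E ⊕ shift p' q' r' E) ⊖ shift p'' q'' r'' E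
⊛-trinomial E p q r p' q' r' p'' q'' r'' =
  ≈-trans (⊛-⊖ʳ E (mono p q r ⊕ mono p' q' r') (mono p'' q'' r''))
    (⊖-cong (≈-trans (⊛-⊕ʳ E (mono p q r) (mono p' q' r')) (⊕-cong (⊛-mono p q r E) (⊛-mono p' q' r' E))) (⊛-mono p'' q'' r'' E))

⊛-D-den : ∀ E → E ⊛ D-den ≈ ⊛D-den-expanded E
⊛-D-den E = ≈-trans (⊛-congʳ E D-den≈expanded)
  (≈-trans (⊛-⊖ʳ E (xyzDen₂ ⊕ xDen₂) den₂Terms) (⊖-cong
    (≈-trans (⊛-⊕ʳ E xyzDen₂ xDen₂) (⊕-cong (⊛-trinomial E 2 2 1 2 1 1 1 1 1) (⊛-trinomial E 2 1 0 2 0 0 1 0 0)))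
    (⊛-trinomial E 1 1 0 1 0 0 0 0 0)))

times[1-x-xyz] : PS → PS
times[1-x-xyz] E = (E ⊖ shift 1 0 0 E) ⊖ shift 1 1 1 E

times[1-x-xy] : PS → PS
times[1-x-xy] K = (K ⊖ shift 1 0 0 K) ⊖ shift 1 1 0 K

times[1-x-xy]-cong : ∀ {E F} → E ≈ F → times[1-x-xy] E ≈ times[1-x-xy] F
times[1-x-xy]-cong e = ⊖-cong (⊖-cong e (shift-cong 1 0 0 e)) (shift-cong 1 1 0 e)

⊛D-den-expanded≈factored : ∀ E → ⊛D-den-expanded E ≈ times[1-x-xy] (times[1-x-xyz] E)
⊛D-den-expanded≈factored E n a b = sym (begin
  times[1-x-xy] (times[1-x-xyz] E) n a b
    ≡⟨ cong₂ (λ u v → (times[1-x-xyz] E n a b Z.- u) Z.- v) (shift-by-x n a b) (shift-by-xy n a b) ⟩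
  (times[1-x-xyz] E n a b Z.- ((s 1 0 0 Z.- s 2 0 0) Z.- s 2 1 1)) Z.- ((s 1 1 0 Z.- s 2 1 0) Z.- s 2 2 1)
    ≡⟨ solve 8 (λ e s100 s111 s110 s200 s211 s210 s221 →
         ((e :- s100) :- s111 :- ((s100 :- s200) :- s211)) :- ((s110 :- s210) :- s221)
         := (((s221 :+ s211) :- s111 :+ ((s210 :+ s200) :- s100)) :- ((s110 :+ s100) :- e))) refl
         (E n a b) (s 1 0 0) (s 1 1 1) (s 1 1 0) (s 2 0 0) (s 2 1 1) (s 2 1 0) (s 2 2 1) ⟩
  ⊛D-den-expanded E n a b ∎)
  where
  open ≡-Reasoning
  s : ℕ → ℕ → ℕ → ℤ
  s p q r = shift p q r E n a b
  shift-by-x : shift 1 0 0 (times[1-x-xyz] E) ≈ (shift 1 0 0 E ⊖ shift 2 0 0 E) ⊖ shift 2 1 1 E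
  shift-by-x = ≈-trans (shift-⊖ 1 0 0 (E ⊖ shift 1 0 0 E) (shift 1 1 1 E))
    (⊖-cong (≈-trans (shift-⊖ 1 0 0 E (shift 1 0 0 E)) (⊖-cong (≈-refl {shift 1 0 0 E}) (shift-shift 1 0 0 1 0 0 E)))
            (shift-shift 1 0 0 1 1 1 E))
  shift-by-xy : shift 1 1 0 (times[1-x-xyz] E) ≈ (shift 1 1 0 E ⊖ shift 2 1 0 E) ⊖ shift 2 2 1 E
  shift-by-xy = ≈-trans (shift-⊖ 1 1 0 (E ⊖ shift 1 0 0 E) (shift 1 1 1 E))
    (⊖-cong (≈-trans (shift-⊖ 1 1 0 E (shift 1 0 0 E)) (⊖-cong (≈-refl {shift 1 1 0 E}) (shift-shift 1 1 0 1 0 0 E)))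
            (shift-shift 1 1 0 1 1 1 E))

dSeries : PS
dSeries n a b = + dCount n a b

kSeries : PS
kSeries n a b = + kCount n a b

+[x+y+k]-x-y≡k : ∀ x y k → (+ ((x + y) + k) Z.- + x) Z.- + y ≡ + k
+[x+y+k]-x-y≡k x y k rewrite ZP.pos-+ (x + y) k | ZP.pos-+ x y =
  solve 3 (λ x y k → ((x :+ y) :+ k :- x) :- y := k) refl (+ x) (+ y) (+ k)

+u-x-y≡0 : ∀ {u x y} → u ≡ x + 1 * y → (+ u Z.- + x) Z.- + y ≡ + 0
+u-x-y≡0 {u} {x} {y} refl = begin
  (+ (x + 1 * y) Z.- + x) Z.- + y      ≡⟨ cong (λ z → (+ z Z.- + x) Z.- + y) (trans (cong (_+_ x) (*-identityˡ y)) (sym (+-identityʳ (x + y)))) ⟩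
  (+ ((x + y) + 0) Z.- + x) Z.- + y    ≡⟨ +[x+y+k]-x-y≡k x y 0 ⟩
  + 0                                  ∎
  where open ≡-Reasoning

times[1-x-xyz]-dSeries : times[1-x-xyz] dSeries ≈ kSeries
times[1-x-xyz]-dSeries zero a b = refl
times[1-x-xyz]-dSeries (suc n) zero b rewrite dCount-suc n zero b =
  +[x+y+k]-x-y≡k (dCount n zero b) 0 (kCount (suc n) zero b)
times[1-x-xyz]-dSeries (suc n) (suc a) zero rewrite dCount-suc n (suc a) zero =
  +[x+y+k]-x-y≡k (dCount n (suc a) zero) 0 (kCount (suc n) (suc a) zero)
times[1-x-xyz]-dSeries (suc n) (suc a) (suc b) rewrite dCount-suc n (suc a) (suc b) | *-identityˡ (dCount n a b) =
  +[x+y+k]-x-y≡k (dCount n (suc a) (suc b)) (dCount n a b) (kCount (suc n) (suc a) (suc b))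

-- In degrees n ≤ 2 in x this is a finite computation; above, it is Pascal's rule `kCount-pascal`.
times[1-x-xy]-kSeries : times[1-x-xy] kSeries ≈ shift 1 1 1 (mono 1 2 1 ⊖ X ⊕ 𝟙)
times[1-x-xy]-kSeries zero a b = refl
times[1-x-xy]-kSeries (suc zero) zero b = refl
times[1-x-xy]-kSeries (suc zero) (suc zero) zero = refl
times[1-x-xy]-kSeries (suc zero) (suc zero) (suc zero) = refl
times[1-x-xy]-kSeries (suc zero) (suc zero) (suc (suc b)) = refl
times[1-x-xy]-kSeries (suc zero) (suc (suc a)) zero = refl
times[1-x-xy]-kSeries (suc zero) (suc (suc a)) (suc zero) = refl
times[1-x-xy]-kSeries (suc zero) (suc (suc a)) (suc (suc b)) = refl
times[1-x-xy]-kSeries (suc (suc zero)) zero zero = refl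
times[1-x-xy]-kSeries (suc (suc zero)) zero (suc zero) = refl
times[1-x-xy]-kSeries (suc (suc zero)) zero (suc (suc zero)) = refl
times[1-x-xy]-kSeries (suc (suc zero)) zero (suc (suc (suc b))) = refl
times[1-x-xy]-kSeries (suc (suc zero)) (suc zero) zero = refl
times[1-x-xy]-kSeries (suc (suc zero)) (suc zero) (suc zero) = refl
times[1-x-xy]-kSeries (suc (suc zero)) (suc zero) (suc (suc zero)) = refl
times[1-x-xy]-kSeries (suc (suc zero)) (suc zero) (suc (suc (suc b))) = refl
times[1-x-xy]-kSeries (suc (suc zero)) (suc (suc zero)) zero = refl
times[1-x-xy]-kSeries (suc (suc zero)) (suc (suc zero)) (suc zero) = refl
times[1-x-xy]-kSeries (suc (suc zero)) (suc (suc zero)) (suc (suc zero)) = refl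
times[1-x-xy]-kSeries (suc (suc zero)) (suc (suc zero)) (suc (suc (suc b))) = refl
times[1-x-xy]-kSeries (suc (suc zero)) (suc (suc (suc zero))) zero = refl
times[1-x-xy]-kSeries (suc (suc zero)) (suc (suc (suc zero))) (suc zero) = refl
times[1-x-xy]-kSeries (suc (suc zero)) (suc (suc (suc zero))) (suc (suc zero)) = refl
times[1-x-xy]-kSeries (suc (suc zero)) (suc (suc (suc zero))) (suc (suc (suc b))) = refl
times[1-x-xy]-kSeries (suc (suc zero)) (suc (suc (suc (suc a)))) zero = refl
times[1-x-xy]-kSeries (suc (suc zero)) (suc (suc (suc (suc a)))) (suc zero) = refl
times[1-x-xy]-kSeries (suc (suc zero)) (suc (suc (suc (suc a)))) (suc (suc zero)) = refl
times[1-x-xy]-kSeries (suc (suc zero)) (suc (suc (suc (suc a)))) (suc (suc (suc b))) = refl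
times[1-x-xy]-kSeries (suc (suc (suc M))) zero b rewrite kCount-pascal M zero b | +-identityʳ (kCount (suc (suc M)) zero b) =
  trans (ZP.+-identityʳ _) (ZP.+-inverseʳ (+ kCount (suc (suc M)) zero b))
times[1-x-xy]-kSeries (suc (suc (suc M))) (suc a) zero =
  +u-x-y≡0 {x = kCount (suc (suc M)) (suc a) zero} {y = kCount (suc (suc M)) a zero} (kCount-pascal M (suc a) zero)
times[1-x-xy]-kSeries (suc (suc (suc M))) (suc a) (suc b) =
  +u-x-y≡0 {x = kCount (suc (suc M)) (suc a) (suc b)} {y = kCount (suc (suc M)) a (suc b)} (kCount-pascal M (suc a) (suc b))

dSeries-solves : dSeries ⊛ D-den ≈ D-num
dSeries-solves = begin
  dSeries ⊛ D-den                          ≈⟨ ⊛-D-den dSeries ⟩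
  ⊛D-den-expanded dSeries                  ≈⟨ ⊛D-den-expanded≈factored dSeries ⟩
  times[1-x-xy] (times[1-x-xyz] dSeries)   ≈⟨ times[1-x-xy]-cong times[1-x-xyz]-dSeries ⟩
  times[1-x-xy] kSeries                    ≈⟨ times[1-x-xy]-kSeries ⟩
  shift 1 1 1 (mono 1 2 1 ⊖ X ⊕ 𝟙)         ≈⟨ ≈-sym (mono-⊛ 1 1 1 (mono 1 2 1 ⊖ X ⊕ 𝟙)) ⟩
  D-num                                    ∎
  where open ≈-Reasoning

shift-vanishes : ∀ p q r E n a b → 1 ≤ p → (∀ {n'} → n' < n → ∀ a b → E n' a b ≡ + 0) → shift p q r E n a b ≡ + 0
shift-vanishes p q r E n a b 1≤p ih with p ≤? n
... | no p≰n rewrite ≤ᵇ-false p≰n = refl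
... | yes p≤n rewrite ≤ᵇ-true p≤n with q ≤ᵇ a | r ≤ᵇ b
...   | true | true = ih (∸-monoʳ-< {o = 0} 1≤p p≤n) (a ∸ q) (b ∸ r)
...   | true | false = refl
...   | false | _ = refl

-- D-den has constant term 1, so the coefficients of E are determined one x-degree at a time.
⊛D-den≈𝟘⇒≈𝟘 : ∀ E → E ⊛ D-den ≈ 𝟘 → E ≈ 𝟘
⊛D-den≈𝟘⇒≈𝟘 E E⊛D-den≈𝟘 n = <-rec (λ n → ∀ a b → E n a b ≡ + 0) step n
  where
  step : ∀ n → (∀ {n'} → n' < n → ∀ a b → E n' a b ≡ + 0) → ∀ a b → E n a b ≡ + 0
  step n ih a b = begin
    E n a b                    ≡⟨ sym only-E-survives ⟩
    ⊛D-den-expanded E n a b    ≡⟨ sym (⊛-D-den E n a b) ⟩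
    (E ⊛ D-den) n a b          ≡⟨ E⊛D-den≈𝟘 n a b ⟩
    + 0                        ∎
    where
    open ≡-Reasoning
    vanish : ∀ p q r → 1 ≤ p → shift p q r E n a b ≡ + 0
    vanish p q r 1≤p = shift-vanishes p q r E n a b 1≤p ih
    only-E-survives : ⊛D-den-expanded E n a b ≡ E n a b
    only-E-survives rewrite vanish 2 2 1 (s≤s z≤n) | vanish 2 1 1 (s≤s z≤n) | vanish 1 1 1 (s≤s z≤n)
      | vanish 2 1 0 (s≤s z≤n) | vanish 2 0 0 (s≤s z≤n) | vanish 1 0 0 (s≤s z≤n) | vanish 1 1 0 (s≤s z≤n) =
      solve 1 (λ e → ((con (+ 0) :+ con (+ 0)) :- con (+ 0) :+ ((con (+ 0) :+ con (+ 0)) :- con (+ 0))) :- ((con (+ 0) :+ con (+ 0)) :- e) := e) refl (E n a b)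

D≈dSeries : ∀ D → D ⊛ D-den ≈ D-num → D ≈ dSeries
D≈dSeries D hyp n a b = ZP.i-j≡0⇒i≡j (D n a b) (dSeries n a b) (⊛D-den≈𝟘⇒≈𝟘 (D ⊖ dSeries) difference n a b)
  where
  difference : (D ⊖ dSeries) ⊛ D-den ≈ 𝟘
  difference n a b = begin
    ((D ⊖ dSeries) ⊛ D-den) n a b            ≡⟨ ⊛-⊖ˡ D-den D dSeries n a b ⟩
    (D ⊛ D-den) n a b Z.- (dSeries ⊛ D-den) n a b ≡⟨ cong₂ Z._-_ (hyp n a b) (dSeries-solves n a b) ⟩
    D-num n a b Z.- D-num n a b              ≡⟨ ZP.+-inverseʳ (D-num n a b) ⟩
    + 0                                      ∎
    where open ≡-Reasoning

dSeries⊛F-UD : ∀ n a b → (dSeries ⊛ F-UD) n a b ≡ + Σℕ n (dConv n a b)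
dSeries⊛F-UD n a b = trans (Σ≤-cong n (λ i → trans (Σ≤-cong a (λ j → trans (Σ≤-cong b (λ k →
    sym (ZP.pos-* (dCount i j k) (countUD (n ∸ i) (a ∸ j) (b ∸ k))))) (Σ≤-pos b _))) (Σ≤-pos a _))) (Σ≤-pos n _)

countUD-0 : ∀ a b → + countUD 0 a b ≡ (𝟙 0 a b Z.+ + 0) Z.+ + 0
countUD-0 zero zero = refl
countUD-0 zero (suc b) = refl
countUD-0 (suc a) b = refl

F-UD-equation : F-UD ≈ 𝟙 ⊕ shift 1 0 0 F-UD ⊕ dSeries ⊛ F-UD
F-UD-equation n a b = trans (coefficient n) (cong (Z._+_ (𝟙 n a b Z.+ shift 1 0 0 F-UD n a b)) (sym (dSeries⊛F-UD n a b)))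
  where
  coefficient : ∀ n → F-UD n a b ≡ 𝟙 n a b Z.+ shift 1 0 0 F-UD n a b Z.+ + Σℕ n (dConv n a b)
  coefficient zero rewrite dConv-0 0 a b = countUD-0 a b
  coefficient (suc n) rewrite countUD-suc n a b = ZP.pos-+ (countUD n a b) _

proposition8p2 : (D : PS) → D ⊛ D-den ≈ D-num →
    F-UD ≈ 𝟙 ⊕ X ⊛ F-UD ⊕ D ⊛ F-UD
proposition8p2 D hyp = begin
  F-UD                                    ≈⟨ F-UD-equation ⟩
  𝟙 ⊕ shift 1 0 0 F-UD ⊕ dSeries ⊛ F-UD   ≈⟨ ⊕-cong (⊕-cong (≈-refl {𝟙}) (≈-sym (mono-⊛ 1 0 0 F-UD)))
                                                        (⊛-congˡ F-UD (≈-sym (D≈dSeries D hyp))) ⟩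
  𝟙 ⊕ X ⊛ F-UD ⊕ D ⊛ F-UD                 ∎
  where open ≈-Reasoning
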